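{- (a) For all integers $n \geq 1$, $n/2 \leq p_{3,4}(-f_{3,1}(n)) \leq (3n-1)/2$. The lower bound is attained precisely when $(n)_4 \in \{0,1\}^*0$, and the upper bound is attained precisely when $(n)_4 \in \{1\} \cup 2^*3$. (b) For all integers $n \geq 1$, $(n/2)^{\frac{\log 3}{\log 4}} \leq -f_{3,1}(n) \leq \big((9n-3)/4\big)^{\frac{\log 3}{\log 4}}$.
   Context: Let $t(n)$ be the number of $1$'s in the base-$2$ representation of $n$, taken modulo $2$. Define $f_{3,1}(n) = \sum_{0 \leq i < n} (-1)^{t(3i+1)}$ for $n \geq 0$ (these values are nonpositive). For an integer $c \geq 2$, $(n)_c$ is the base-$c$ representation of $n\ge 0$ (most significant digit first, no leading zeros), and for a digit word $x = a_1\cdots a_t$, $[x]_c = \sum_{i=1}^t a_i c^{t-i}$. Define $p_{3,4}(m) = [(m)_3]_4$ for $m \geq 0$. In regular expressions $^*$ is Kleene star and juxtaposition is concatenation. -}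

module Defs where

open import Data.Nat using (ℕ; zero; suc; _+_; _*_; _%_; _/_; NonZero)
open import Data.Nat.ListAction using (sum)
open import Data.List using (List; []; _∷_; reverse)
open import Data.Integer as ℤ using (ℤ; +_; -_)

-- Least-significant-digit-first digits of n in base c, with fuel.
-- For c ≥ 2 the fuel n is always sufficient.
digitsRevAux : (c : ℕ) → .{{NonZero c}} → ℕ → ℕ → List ℕ
digitsRevAux c zero    _         = []
digitsRevAux c (suc f) zero      = []
digitsRevAux c (suc f) n@(suc _) = (n % c) ∷ digitsRevAux c f (n / c)

-- (n)_c : base-c representation, most significant digit first, no leading
-- zeros; (0)_c is the empty word.
digits : (c : ℕ) → .{{NonZero c}} → ℕ → List ℕ
digits c n = reverse (digitsRevAux c n n)

evalDigits : ℕ → List ℕ → ℕ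
evalDigits c xs = go 0 xs
  where
  go : ℕ → List ℕ → ℕ
  go acc []       = acc
  go acc (a ∷ as) = go (acc * c + a) as

t : ℕ → ℕ
t n = sum (digits 2 n) % 2

negOnePow : ℕ → ℤ
negOnePow zero    = + 1
negOnePow (suc k) = - negOnePow k

f31 : ℕ → ℤ
f31 zero    = + 0
f31 (suc n) = f31 n ℤ.+ negOnePow (t (3 * n + 1))

p34 : ℕ → ℕ
p34 m = evalDigits 4 (digits 3 m)

data In01Star0 : List ℕ → Set where
  end0 : In01Star0 (0 ∷ [])
  cons0 : ∀ {xs} → In01Star0 xs → In01Star0 (0 ∷ xs)
  cons1 : ∀ {xs} → In01Star0 xs → In01Star0 (1 ∷ xs)

data In2Star3 : List ℕ → Set where
  end3  : In2Star3 (3 ∷ [])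
  cons2 : ∀ {xs} → In2Star3 xs → In2Star3 (2 ∷ xs)

-- Put g = −f31 and tm i = (−1)^(t i), so that g (n + 1) = g n − tm (3n + 1), tm (2i) = tm i and
-- tm (2i + 1) = −tm i. Summing over a block of four gives g (4k) = 3 g k for even k and
-- g (4k) = 3 g k − tm (3k) for odd k, and inside the block g moves by steps ±1 whose signs are
-- values of tm near 3k. Hence g (4k + r) = 3 g k′ + d with a digit d < 3 and k′ ∈ {k − 1, k, k + 1},
-- so p34 (g (4k + r)) = 4 p34 (g k′) + d: appending a base-4 digit to n appends a base-3 digit to
-- g n. Strong induction carries n ≤ 2 p34 (g n) ≤ 3n − 1, with its equality cases, from k′ to
-- 4k + r; when k′ ≠ k, the strict monotonicity of p34 absorbs the shift. Part (b) follows from (a)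
-- and the estimates p34 m ^ q ≤ m ^ p (if 4^q < 3^p) and 2^q m^p ≤ (3 p34 m)^q (if 3^p < 4^q),
-- both proved by induction on the base-3 digits of m.

module Submission where

open import Defs
open import Data.Nat using (ℕ; _+_; _*_; _^_; _∸_; _≤_; _<_)
open import Data.Integer using (+_; -_)
open import Data.List using (List; []; _∷_)
open import Data.Product using (_×_)
open import Data.Sum using (_⊎_)
open import Function.Bundles using (_⇔_)
open import Relation.Binary.PropositionalEquality using (_≡_)

open import Data.Nat using (zero; suc; pred; NonZero; >-nonZero; _%_; _/_; _<?_; _≤?_; z≤n; s≤s)
open import Data.Nat.Properties
open import Data.Nat.DivMod
  using (m≡m%n+[m/n]*n; m%n<n; [m+kn]%n≡m%n; m<n⇒m%n≡m; m*n%n≡0; +-distrib-/; m*n/n≡m; m<n⇒m/n≡0; m/n<m)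
open import Data.Nat.Induction using (<-rec)
open import Data.Nat.ListAction using (sum)
open import Data.Nat.ListAction.Properties using (sum-++)
import Data.Nat.Tactic.RingSolver as ℕ-Solver
open import Data.Integer as ℤ using (ℤ; 1ℤ; -1ℤ; 0ℤ)
import Data.Integer.Properties as ℤ
import Data.Integer.Tactic.RingSolver as ℤ-Solver
open import Data.List using (_++_; _∷ʳ_; reverse)
open import Data.List.Properties using (unfold-reverse; ∷ʳ-injective; ++-conicalʳ)
open import Data.List.Relation.Unary.All as All using (All)
open import Data.List.Relation.Unary.All.Properties using (∷ʳ⁺; ∷ʳ⁻)
open import Data.Product using (∃; ∃₂; _,_; proj₁; proj₂)
open import Data.Sum using (inj₁; inj₂)
import Data.Sum as Sum
open import Data.Sum.Function.Propositional using (_⊎-⇔_)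
open import Function.Bundles using (mk⇔; Equivalence)
open import Function.Properties.Equivalence using () renaming (sym to ⇔-sym; trans to ⇔-trans)
open import Relation.Nullary using (¬_; yes; no; contradiction)
open import Relation.Nullary.Decidable using (from-yes)
open import Relation.Binary.PropositionalEquality
  using (_≢_; refl; sym; trans; cong; cong₂; subst; subst₂; module ≡-Reasoning)

-- Digits

digitsRevAux-zero : ∀ {c} .{{_ : NonZero c}} f → digitsRevAux c f 0 ≡ []
digitsRevAux-zero zero    = refl
digitsRevAux-zero (suc f) = refl

digitsRevAux-fuel : ∀ c .{{_ : NonZero c}} → 1 < c → ∀ {f f′} n → n ≤ f → n ≤ f′ →
                    digitsRevAux c f n ≡ digitsRevAux c f′ n
digitsRevAux-fuel c 1<c {f} {f′} zero _ _ = trans (digitsRevAux-zero f) (sym (digitsRevAux-zero f′))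
digitsRevAux-fuel c 1<c {suc f} {suc f′} n@(suc _) (s≤s n≤f) (s≤s n≤f′) =
  cong (n % c ∷_) (digitsRevAux-fuel c 1<c (n / c) (shrink n≤f) (shrink n≤f′))
  where
  shrink : ∀ {h} → pred n ≤ h → n / c ≤ h
  shrink = ≤-trans (<⇒≤pred (m/n<m n c 1<c))

digits-step : ∀ c .{{_ : NonZero c}} → 1 < c → ∀ n → 0 < n → digits c n ≡ digits c (n / c) ∷ʳ n % c
digits-step c 1<c n@(suc m) _ = begin
  reverse (n % c ∷ digitsRevAux c m (n / c))   ≡⟨ unfold-reverse (n % c) (digitsRevAux c m (n / c)) ⟩
  reverse (digitsRevAux c m (n / c)) ∷ʳ n % c  ≡⟨ cong (λ ds → reverse ds ∷ʳ n % c) fuel ⟩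
  digits c (n / c) ∷ʳ n % c                     ∎
  where
  open ≡-Reasoning
  fuel : digitsRevAux c m (n / c) ≡ digitsRevAux c (n / c) (n / c)
  fuel = digitsRevAux-fuel c 1<c (n / c) (<⇒≤pred (m/n<m n c 1<c)) ≤-refl

[n*q+r]%n≡r : ∀ n .{{_ : NonZero n}} q {r} → r < n → (n * q + r) % n ≡ r
[n*q+r]%n≡r n q {r} r<n = begin
  (n * q + r) % n  ≡⟨ cong (_% n) (+-comm (n * q) r) ⟩
  (r + n * q) % n  ≡⟨ cong (λ x → (r + x) % n) (*-comm n q) ⟩
  (r + q * n) % n  ≡⟨ [m+kn]%n≡m%n r q n ⟩
  r % n            ≡⟨ m<n⇒m%n≡m r<n ⟩
  r                ∎
  where open ≡-Reasoning

[n*q+r]/n≡q : ∀ n .{{_ : NonZero n}} q {r} → r < n → (n * q + r) / n ≡ q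
[n*q+r]/n≡q n q {r} r<n = begin
  (n * q + r) / n      ≡⟨ +-distrib-/ (n * q) r remainders<n ⟩
  n * q / n + r / n    ≡⟨ cong₂ _+_ (trans (cong (_/ n) (*-comm n q)) (m*n/n≡m q n)) (m<n⇒m/n≡0 r<n) ⟩
  q + 0                ≡⟨ +-identityʳ q ⟩
  q                    ∎
  where
  open ≡-Reasoning
  nq%n≡0 : (n * q) % n ≡ 0
  nq%n≡0 = trans (cong (_% n) (*-comm n q)) (m*n%n≡0 q n)
  remainders<n : (n * q) % n + r % n < n
  remainders<n = subst (_< n) (sym (cong₂ _+_ nq%n≡0 (m<n⇒m%n≡m r<n))) r<n

digits-∷ʳ : ∀ c .{{_ : NonZero c}} → 1 < c → ∀ q {r} → r < c → 0 < c * q + r →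
            digits c (c * q + r) ≡ digits c q ∷ʳ r
digits-∷ʳ c 1<c q r<c 0<n =
  trans (digits-step c 1<c _ 0<n) (cong₂ (λ x y → digits c x ∷ʳ y) ([n*q+r]/n≡q c q r<c) ([n*q+r]%n≡r c q r<c))

divide : ∀ c .{{_ : NonZero c}} n → ∃₂ λ q r → r < c × n ≡ c * q + r
divide c n = n / c , n % c , m%n<n n c , (begin
  n                  ≡⟨ m≡m%n+[m/n]*n n c ⟩
  n % c + n / c * c  ≡⟨ +-comm (n % c) _ ⟩
  n / c * c + n % c  ≡⟨ cong (_+ n % c) (*-comm (n / c) c) ⟩
  c * (n / c) + n % c ∎)
  where open ≡-Reasoning

q<c*q+r : ∀ c .{{_ : NonZero c}} → 1 < c → ∀ q r → 0 < c * q + r → q < c * q + r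
q<c*q+r c 1<c zero    r 0<r = 0<r
q<c*q+r c 1<c q@(suc _) r _ = ≤-trans (subst (q <_) (*-comm q c) (m<m*n q c 1<c)) (m≤m+n (c * q) r)

base-induction : ∀ c .{{_ : NonZero c}} → 1 < c → (P : ℕ → Set) → P 0 →
                 (∀ q {r} → r < c → 0 < c * q + r → P q → P (c * q + r)) → ∀ n → P n
base-induction c 1<c P P0 step = <-rec P go
  where
  go : ∀ n → (∀ {m} → m < n → P m) → P n
  go zero      _   = P0
  go n@(suc _) rec with divide c n
  ... | q , r , r<c , n≡c*q+r = subst P (sym n≡c*q+r)
    (step q r<c 0<c*q+r (rec (subst (q <_) (sym n≡c*q+r) (q<c*q+r c 1<c q r 0<c*q+r))))
    where
    0<c*q+r : 0 < c * q + r
    0<c*q+r = subst (0 <_) n≡c*q+r (s≤s z≤n)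

-- The recursive call relies on evalDigits c (a ∷ x ∷ xs) and evalDigits c (a * c + x ∷ xs) being
-- definitionally equal (Horner's scheme).
evalDigits-∷-∷ʳ : ∀ c a xs d → evalDigits c (a ∷ xs ∷ʳ d) ≡ evalDigits c (a ∷ xs) * c + d
evalDigits-∷-∷ʳ c a []       d = refl
evalDigits-∷-∷ʳ c a (x ∷ xs) d = evalDigits-∷-∷ʳ c (a * c + x) xs d

evalDigits-∷ʳ : ∀ c xs d → evalDigits c (xs ∷ʳ d) ≡ c * evalDigits c xs + d
evalDigits-∷ʳ c []       d = cong (_+ d) (sym (*-zeroʳ c))
evalDigits-∷ʳ c (a ∷ xs) d = trans (evalDigits-∷-∷ʳ c a xs d) (cong (_+ d) (*-comm _ c))

p34-step⁺ : ∀ y {d} → d < 3 → 0 < 3 * y + d → p34 (3 * y + d) ≡ 4 * p34 y + d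
p34-step⁺ y {d} d<3 0<n =
  trans (cong (evalDigits 4) (digits-∷ʳ 3 (s≤s (s≤s z≤n)) y d<3 0<n)) (evalDigits-∷ʳ 4 (digits 3 y) d)

p34-step : ∀ y {d} → d < 3 → p34 (3 * y + d) ≡ 4 * p34 y + d
p34-step zero    {zero}  _   = refl
p34-step zero    {suc d} d<3 = p34-step⁺ zero d<3 (s≤s z≤n)
p34-step (suc y) {d}     d<3 = p34-step⁺ (suc y) d<3 (≤-trans (s≤s z≤n) (m≤m+n (3 * suc y) d))

p34-<-suc : ∀ y → p34 y < p34 (suc y)
p34-<-suc = base-induction 3 (s≤s (s≤s z≤n)) (λ y → p34 y < p34 (suc y)) (s≤s z≤n) step
  where
  open ≤-Reasoning
  next-digit : ∀ q {r} → suc r < 3 → p34 (3 * q + r) < p34 (suc (3 * q + r))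
  next-digit q {r} r+1<3 = begin-strict
    p34 (3 * q + r)       ≡⟨ p34-step q (<-trans (n<1+n r) r+1<3) ⟩
    4 * p34 q + r         <⟨ +-monoʳ-< (4 * p34 q) (n<1+n r) ⟩
    4 * p34 q + suc r     ≡⟨ p34-step q r+1<3 ⟨
    p34 (3 * q + suc r)   ≡⟨ cong p34 (+-suc (3 * q) r) ⟩
    p34 (suc (3 * q + r)) ∎

  step : ∀ q {r} → r < 3 → 0 < 3 * q + r → p34 q < p34 (suc q) → p34 (3 * q + r) < p34 (suc (3 * q + r))
  step q {2} r<3 _ ih = begin-strict
    p34 (3 * q + 2)       ≡⟨ p34-step q r<3 ⟩
    4 * p34 q + 2         <⟨ +-monoʳ-< (4 * p34 q) (s≤s (s≤s (s≤s z≤n))) ⟩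
    4 * p34 q + 4         ≡⟨ trans (*-suc 4 (p34 q)) (+-comm 4 _) ⟨
    4 * suc (p34 q)       ≤⟨ *-monoʳ-≤ 4 ih ⟩
    4 * p34 (suc q)       ≡⟨ +-identityʳ _ ⟨
    4 * p34 (suc q) + 0   ≡⟨ p34-step (suc q) {0} (s≤s z≤n) ⟨
    p34 (3 * suc q + 0)   ≡⟨ cong p34 {3 * suc q + 0} {suc (3 * q + 2)} (ℕ-Solver.solve (q ∷ [])) ⟩
    p34 (suc (3 * q + 2)) ∎
  step q {0} _ _ _ = next-digit q (s≤s (s≤s z≤n))
  step q {1} _ _ _ = next-digit q (s≤s (s≤s (s≤s z≤n)))
  step q {suc (suc (suc _))} (s≤s (s≤s (s≤s ()))) _ _

y≤p34y : ∀ y → y ≤ p34 y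
y≤p34y = base-induction 3 (s≤s (s≤s z≤n)) (λ y → y ≤ p34 y) z≤n step
  where
  open ≤-Reasoning
  step : ∀ q {r} → r < 3 → 0 < 3 * q + r → q ≤ p34 q → 3 * q + r ≤ p34 (3 * q + r)
  step q {r} r<3 _ ih = begin
    3 * q + r       ≤⟨ +-monoˡ-≤ r (*-mono-≤ (n≤1+n 3) ih) ⟩
    4 * p34 q + r   ≡⟨ p34-step q r<3 ⟨
    p34 (3 * q + r) ∎

-- Thue–Morse signs and the walk g

tm : ℕ → ℤ
tm n = negOnePow (t n)

negOnePow-%2 : ∀ k → negOnePow (k % 2) ≡ negOnePow k
negOnePow-%2 zero          = refl
negOnePow-%2 (suc zero)    = refl
negOnePow-%2 (suc (suc k)) = trans (negOnePow-%2 k) (sym (ℤ.neg-involutive (negOnePow k)))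

negOnePow-±1 : ∀ k → negOnePow k ≡ 1ℤ ⊎ negOnePow k ≡ -1ℤ
negOnePow-±1 zero = inj₁ refl
negOnePow-±1 (suc k) with negOnePow-±1 k
... | inj₁ ≡1  = inj₂ (cong -_ ≡1)
... | inj₂ ≡-1 = inj₁ (cong -_ ≡-1)

tm-±1 : ∀ n → tm n ≡ 1ℤ ⊎ tm n ≡ -1ℤ
tm-±1 n = negOnePow-±1 (t n)

t-2*+ : ∀ k {b} → b < 2 → 0 < 2 * k + b → t (2 * k + b) ≡ (sum (digits 2 k) + b) % 2
t-2*+ k {b} b<2 0<n = cong (_% 2) (begin
  sum (digits 2 (2 * k + b))            ≡⟨ cong sum (digits-∷ʳ 2 (s≤s (s≤s z≤n)) k b<2 0<n) ⟩
  sum (digits 2 k ++ b ∷ [])           ≡⟨ sum-++ (digits 2 k) (b ∷ []) ⟩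
  sum (digits 2 k) + (b + 0)            ≡⟨ cong (λ x → sum (digits 2 k) + x) (+-identityʳ b) ⟩
  sum (digits 2 k) + b                  ∎)
  where open ≡-Reasoning

tm-2* : ∀ k → tm (2 * k) ≡ tm k
tm-2* zero        = refl
tm-2* k@(suc _) = begin
  negOnePow (t (2 * k))                ≡⟨ cong tm {2 * k + 0} {2 * k} (+-identityʳ (2 * k)) ⟨
  negOnePow (t (2 * k + 0))            ≡⟨ cong negOnePow (t-2*+ k (s≤s z≤n) (s≤s z≤n)) ⟩
  negOnePow ((sum (digits 2 k) + 0) % 2) ≡⟨ cong (λ s → negOnePow (s % 2)) (+-identityʳ (sum (digits 2 k))) ⟩
  tm k                                 ∎
  where open ≡-Reasoning

tm-2*+1 : ∀ k → tm (2 * k + 1) ≡ - tm k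
tm-2*+1 k = begin
  negOnePow (t (2 * k + 1))              ≡⟨ cong negOnePow (t-2*+ k (s≤s (s≤s z≤n)) 0<2k+1) ⟩
  negOnePow ((sum (digits 2 k) + 1) % 2) ≡⟨ negOnePow-%2 (sum (digits 2 k) + 1) ⟩
  negOnePow (sum (digits 2 k) + 1)       ≡⟨ cong negOnePow (+-comm (sum (digits 2 k)) 1) ⟩
  - negOnePow (sum (digits 2 k))         ≡⟨ cong -_ (negOnePow-%2 (sum (digits 2 k))) ⟨
  - tm k                                 ∎
  where
  open ≡-Reasoning
  0<2k+1 : 0 < 2 * k + 1
  0<2k+1 = subst (0 <_) (+-comm 1 (2 * k)) (s≤s z≤n)

tm-even : ∀ n m → n ≡ 2 * m → tm n ≡ tm m
tm-even _ m refl = tm-2* m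

tm-odd : ∀ n m → n ≡ 2 * m + 1 → tm n ≡ - tm m
tm-odd _ m refl = tm-2*+1 m

tm-3[4k]+1 : ∀ k → tm (3 * (4 * k) + 1) ≡ - tm (3 * k)
tm-3[4k]+1 k = begin
  tm (3 * (4 * k) + 1)  ≡⟨ tm-odd (3 * (4 * k) + 1) (2 * (3 * k)) (ℕ-Solver.solve (k ∷ [])) ⟩
  - tm (2 * (3 * k))    ≡⟨ cong -_ (tm-2* (3 * k)) ⟩
  - tm (3 * k)          ∎
  where open ≡-Reasoning

tm-3[4k+1]+1 : ∀ k → tm (3 * (4 * k + 1) + 1) ≡ tm (3 * k + 1)
tm-3[4k+1]+1 k = begin
  tm (3 * (4 * k + 1) + 1)  ≡⟨ tm-even (3 * (4 * k + 1) + 1) (2 * (3 * k + 1)) (ℕ-Solver.solve (k ∷ [])) ⟩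
  tm (2 * (3 * k + 1))      ≡⟨ tm-2* (3 * k + 1) ⟩
  tm (3 * k + 1)            ∎
  where open ≡-Reasoning

tm-3[4k+2]+1 : ∀ k → tm (3 * (4 * k + 2) + 1) ≡ tm (3 * k + 1)
tm-3[4k+2]+1 k = begin
  tm (3 * (4 * k + 2) + 1)   ≡⟨ tm-odd (3 * (4 * k + 2) + 1) (2 * (3 * k + 1) + 1) (ℕ-Solver.solve (k ∷ [])) ⟩
  - tm (2 * (3 * k + 1) + 1) ≡⟨ cong -_ (tm-2*+1 (3 * k + 1)) ⟩
  - - tm (3 * k + 1)         ≡⟨ ℤ.neg-involutive _ ⟩
  tm (3 * k + 1)             ∎
  where open ≡-Reasoning

tm-3[4k+3]+1 : ∀ k → tm (3 * (4 * k + 3) + 1) ≡ - tm (3 * k + 2)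
tm-3[4k+3]+1 k = begin
  tm (3 * (4 * k + 3) + 1)  ≡⟨ tm-even (3 * (4 * k + 3) + 1) (2 * (3 * k + 2) + 1) (ℕ-Solver.solve (k ∷ [])) ⟩
  tm (2 * (3 * k + 2) + 1)  ≡⟨ tm-2*+1 (3 * k + 2) ⟩
  - tm (3 * k + 2)          ∎
  where open ≡-Reasoning

g : ℕ → ℤ
g n = - f31 n

g-step : ∀ m n → m ≡ n + 1 → g m ≡ g n ℤ.- tm (3 * n + 1)
g-step _ n refl = trans (cong g (+-comm n 1)) (ℤ.neg-distrib-+ (f31 n) (tm (3 * n + 1)))

g-4k+1 : ∀ k → g (4 * k + 1) ≡ g (4 * k) ℤ.+ tm (3 * k)
g-4k+1 k = trans (g-step (4 * k + 1) (4 * k) refl)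
                 (cong (λ x → g (4 * k) ℤ.+ x) (trans (cong -_ (tm-3[4k]+1 k)) (ℤ.neg-involutive _)))

g-4k+2 : ∀ k → g (4 * k + 2) ≡ g (4 * k + 1) ℤ.- tm (3 * k + 1)
g-4k+2 k = trans (g-step (4 * k + 2) (4 * k + 1) (sym (+-assoc (4 * k) 1 1)))
                 (cong (λ x → g (4 * k + 1) ℤ.- x) (tm-3[4k+1]+1 k))

g-4k+3 : ∀ k → g (4 * k + 3) ≡ g (4 * k + 2) ℤ.- tm (3 * k + 1)
g-4k+3 k = trans (g-step (4 * k + 3) (4 * k + 2) (sym (+-assoc (4 * k) 2 1)))
                 (cong (λ x → g (4 * k + 2) ℤ.- x) (tm-3[4k+2]+1 k))

g-4k+4 : ∀ k → g (4 * suc k) ≡ g (4 * k + 3) ℤ.+ tm (3 * k + 2)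
g-4k+4 k = trans (g-step (4 * suc k) (4 * k + 3) (ℕ-Solver.solve (k ∷ [])))
                 (cong (λ x → g (4 * k + 3) ℤ.+ x) (trans (cong -_ (tm-3[4k+3]+1 k)) (ℤ.neg-involutive _)))

tm-3[2j] : ∀ j → tm (3 * (2 * j)) ≡ tm (3 * j)
tm-3[2j] j = tm-even (3 * (2 * j)) (3 * j) (ℕ-Solver.solve (j ∷ []))

tm-3[2j]+1 : ∀ j → tm (3 * (2 * j) + 1) ≡ - tm (3 * j)
tm-3[2j]+1 j = tm-odd (3 * (2 * j) + 1) (3 * j) (ℕ-Solver.solve (j ∷ []))

tm-3[2j]+2 : ∀ j → tm (3 * (2 * j) + 2) ≡ tm (3 * j + 1)
tm-3[2j]+2 j = tm-even (3 * (2 * j) + 2) (3 * j + 1) (ℕ-Solver.solve (j ∷ []))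

tm-3[2j+1] : ∀ j → tm (3 * (2 * j + 1)) ≡ - tm (3 * j + 1)
tm-3[2j+1] j = tm-odd (3 * (2 * j + 1)) (3 * j + 1) (ℕ-Solver.solve (j ∷ []))

tm-3[2j+1]+1 : ∀ j → tm (3 * (2 * j + 1) + 1) ≡ tm (3 * j + 2)
tm-3[2j+1]+1 j = tm-even (3 * (2 * j + 1) + 1) (3 * j + 2) (ℕ-Solver.solve (j ∷ []))

tm-3[2j+1]+2 : ∀ j → tm (3 * (2 * j + 1) + 2) ≡ - tm (3 * j + 2)
tm-3[2j+1]+2 j = tm-odd (3 * (2 * j + 1) + 2) (3 * j + 2) (ℕ-Solver.solve (j ∷ []))

defect : ℕ → ℤ
defect k = g (4 * k) ℤ.- + 3 ℤ.* g k

defect-suc : ∀ k → defect (suc k) ≡ defect k ℤ.+ (tm (3 * k) ℤ.+ tm (3 * k + 1) ℤ.+ tm (3 * k + 2))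
defect-suc k = begin
  g (4 * suc k) ℤ.- + 3 ℤ.* g (suc k)
    ≡⟨ cong₂ (λ x y → x ℤ.- + 3 ℤ.* y) g-4[k+1] (g-step (suc k) k (+-comm 1 k)) ⟩
  g (4 * k) ℤ.+ a ℤ.- b ℤ.- b ℤ.+ c ℤ.- + 3 ℤ.* (g k ℤ.- b)
    ≡⟨ regroup (g (4 * k)) (g k) a b c ⟩
  defect k ℤ.+ (a ℤ.+ b ℤ.+ c) ∎
  where
  open ≡-Reasoning
  a b c : ℤ
  a = tm (3 * k)
  b = tm (3 * k + 1)
  c = tm (3 * k + 2)
  g-4[k+1] : g (4 * suc k) ≡ g (4 * k) ℤ.+ a ℤ.- b ℤ.- b ℤ.+ c
  g-4[k+1] = begin
    g (4 * suc k)                    ≡⟨ g-4k+4 k ⟩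
    g (4 * k + 3) ℤ.+ c              ≡⟨ cong (ℤ._+ c) (g-4k+3 k) ⟩
    g (4 * k + 2) ℤ.- b ℤ.+ c        ≡⟨ cong (λ x → x ℤ.- b ℤ.+ c) (g-4k+2 k) ⟩
    g (4 * k + 1) ℤ.- b ℤ.- b ℤ.+ c  ≡⟨ cong (λ x → x ℤ.- b ℤ.- b ℤ.+ c) (g-4k+1 k) ⟩
    g (4 * k) ℤ.+ a ℤ.- b ℤ.- b ℤ.+ c ∎
  regroup : ∀ x y a b c →
            x ℤ.+ a ℤ.- b ℤ.- b ℤ.+ c ℤ.- + 3 ℤ.* (y ℤ.- b) ≡ x ℤ.- + 3 ℤ.* y ℤ.+ (a ℤ.+ b ℤ.+ c)
  regroup = ℤ-Solver.solve-∀

defect-2j : ∀ j → defect (2 * j) ≡ 0ℤ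
defect-2j+1 : ∀ j → defect (2 * j + 1) ≡ - tm (3 * (2 * j + 1))

defect-2j zero    = refl
defect-2j (suc j) = begin
  defect (2 * suc j)        ≡⟨ cong defect {2 * suc j} {suc (2 * j + 1)} (ℕ-Solver.solve (j ∷ [])) ⟩
  defect (suc (2 * j + 1))  ≡⟨ defect-suc (2 * j + 1) ⟩
  defect (2 * j + 1) ℤ.+ (a ℤ.+ tm (3 * (2 * j + 1) + 1) ℤ.+ tm (3 * (2 * j + 1) + 2))
    ≡⟨ cong₂ (λ d x → d ℤ.+ (a ℤ.+ x ℤ.+ tm (3 * (2 * j + 1) + 2))) (defect-2j+1 j) (tm-3[2j+1]+1 j) ⟩
  - a ℤ.+ (a ℤ.+ c ℤ.+ tm (3 * (2 * j + 1) + 2))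
    ≡⟨ cong (λ x → - a ℤ.+ (a ℤ.+ c ℤ.+ x)) (tm-3[2j+1]+2 j) ⟩
  - a ℤ.+ (a ℤ.+ c ℤ.+ - c)  ≡⟨ cancel a c ⟩
  0ℤ                         ∎
  where
  open ≡-Reasoning
  a c : ℤ
  a = tm (3 * (2 * j + 1))
  c = tm (3 * j + 2)
  cancel : ∀ x y → - x ℤ.+ (x ℤ.+ y ℤ.+ - y) ≡ 0ℤ
  cancel = ℤ-Solver.solve-∀

defect-2j+1 j = begin
  defect (2 * j + 1)        ≡⟨ cong defect (+-comm (2 * j) 1) ⟩
  defect (suc (2 * j))      ≡⟨ defect-suc (2 * j) ⟩
  defect (2 * j) ℤ.+ (tm (3 * (2 * j)) ℤ.+ tm (3 * (2 * j) + 1) ℤ.+ tm (3 * (2 * j) + 2))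
    ≡⟨ cong₂ (λ d x → d ℤ.+ (x ℤ.+ tm (3 * (2 * j) + 1) ℤ.+ tm (3 * (2 * j) + 2))) (defect-2j j) (tm-3[2j] j) ⟩
  0ℤ ℤ.+ (tm (3 * j) ℤ.+ tm (3 * (2 * j) + 1) ℤ.+ tm (3 * (2 * j) + 2))
    ≡⟨ cong₂ (λ x y → 0ℤ ℤ.+ (tm (3 * j) ℤ.+ x ℤ.+ y)) (tm-3[2j]+1 j) (tm-3[2j]+2 j) ⟩
  0ℤ ℤ.+ (tm (3 * j) ℤ.+ - tm (3 * j) ℤ.+ tm (3 * j + 1))
    ≡⟨ cancel (tm (3 * j)) (tm (3 * j + 1)) ⟩
  - - tm (3 * j + 1)        ≡⟨ cong -_ (tm-3[2j+1] j) ⟨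
  - tm (3 * (2 * j + 1))    ∎
  where
  open ≡-Reasoning
  cancel : ∀ x y → 0ℤ ℤ.+ (x ℤ.+ - x ℤ.+ y) ≡ - - y
  cancel = ℤ-Solver.solve-∀

g-4[2j] : ∀ j → g (4 * (2 * j)) ≡ + 3 ℤ.* g (2 * j)
g-4[2j] j = ℤ.i-j≡0⇒i≡j _ _ (defect-2j j)

g-4[2j+1] : ∀ j → g (4 * (2 * j + 1)) ≡ + 3 ℤ.* g (2 * j + 1) ℤ.- tm (3 * (2 * j + 1))
g-4[2j+1] j = begin
  g (4 * k)                       ≡⟨ split (g (4 * k)) (+ 3 ℤ.* g k) ⟩
  + 3 ℤ.* g k ℤ.+ defect k        ≡⟨ cong (λ d → + 3 ℤ.* g k ℤ.+ d) (defect-2j+1 j) ⟩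
  + 3 ℤ.* g k ℤ.- tm (3 * k)      ∎
  where
  open ≡-Reasoning
  k : ℕ
  k = 2 * j + 1
  split : ∀ x y → x ≡ y ℤ.+ (x ℤ.- y)
  split = ℤ-Solver.solve-∀

g-next : ∀ k → g (k + 1) ≡ g k ℤ.+ - tm (3 * k + 1)
g-next k = g-step (k + 1) k refl

g-next-even : ∀ j → g (2 * j + 1) ≡ g (2 * j) ℤ.+ tm (3 * (2 * j))
g-next-even j = trans (g-next (2 * j)) (cong (λ x → g (2 * j) ℤ.+ x) (begin
  - tm (3 * (2 * j) + 1)  ≡⟨ cong -_ (tm-3[2j]+1 j) ⟩
  - - tm (3 * j)          ≡⟨ ℤ.neg-involutive _ ⟩
  tm (3 * j)              ≡⟨ tm-3[2j] j ⟨
  tm (3 * (2 * j))        ∎))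
  where open ≡-Reasoning

tm-3[8j+r]+1 : ∀ j r → r ≤ 2 → tm (3 * (4 * (2 * j) + r) + 1) ≡ - tm (3 * (2 * j))
tm-3[8j+r]+1 j 0 _ = trans (cong (λ n → tm (3 * n + 1)) (+-identityʳ (4 * (2 * j)))) (tm-3[4k]+1 (2 * j))
tm-3[8j+r]+1 j 1 _ = trans (tm-3[4k+1]+1 (2 * j)) (trans (tm-3[2j]+1 j) (cong -_ (sym (tm-3[2j] j))))
tm-3[8j+r]+1 j 2 _ = trans (tm-3[4k+2]+1 (2 * j)) (trans (tm-3[2j]+1 j) (cong -_ (sym (tm-3[2j] j))))
tm-3[8j+r]+1 j (suc (suc (suc _))) (s≤s (s≤s ()))

g-even-block : ∀ j r → r ≤ 3 → g (4 * (2 * j) + r) ≡ + 3 ℤ.* g (2 * j) ℤ.+ + r ℤ.* tm (3 * (2 * j))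
g-even-block j zero    _         = begin
  g (4 * (2 * j) + 0)              ≡⟨ cong g (+-identityʳ (4 * (2 * j))) ⟩
  g (4 * (2 * j))                  ≡⟨ g-4[2j] j ⟩
  + 3 ℤ.* g (2 * j)                ≡⟨ ℤ.+-identityʳ _ ⟨
  + 3 ℤ.* g (2 * j) ℤ.+ 0ℤ          ∎
  where open ≡-Reasoning
g-even-block j (suc r) (s≤s r≤2) = begin
  g (4 * k + suc r)
    ≡⟨ g-step _ (4 * k + r) (trans (+-suc (4 * k) r) (+-comm 1 _)) ⟩
  g (4 * k + r) ℤ.- tm (3 * (4 * k + r) + 1)
    ≡⟨ cong₂ ℤ._-_ (g-even-block j r (m≤n⇒m≤1+n r≤2)) (tm-3[8j+r]+1 j r r≤2) ⟩
  + 3 ℤ.* g k ℤ.+ + r ℤ.* a ℤ.- - a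
    ≡⟨ one-more (g k) a (+ r) ⟩
  + 3 ℤ.* g k ℤ.+ + suc r ℤ.* a
    ∎
  where
  open ≡-Reasoning
  k : ℕ
  a : ℤ
  k = 2 * j
  a = tm (3 * k)
  one-more : ∀ x a ρ → + 3 ℤ.* x ℤ.+ ρ ℤ.* a ℤ.- - a ≡ + 3 ℤ.* x ℤ.+ (1ℤ ℤ.+ ρ) ℤ.* a
  one-more = ℤ-Solver.solve-∀

tm-3[4k+r+1]+1 : ∀ k r → r ≤ 1 → tm (3 * (4 * k + suc r) + 1) ≡ tm (3 * k + 1)
tm-3[4k+r+1]+1 k 0 _ = tm-3[4k+1]+1 k
tm-3[4k+r+1]+1 k 1 _ = tm-3[4k+2]+1 k
tm-3[4k+r+1]+1 k (suc (suc _)) (s≤s ())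

g-odd-block : ∀ j r → r ≤ 2 →
              g (4 * (2 * j + 1) + suc r) ≡ + 3 ℤ.* g (2 * j + 1) ℤ.+ + r ℤ.* - tm (3 * (2 * j + 1) + 1)
g-odd-block j zero    _         = begin
  g (4 * k + 1)                   ≡⟨ g-4k+1 k ⟩
  g (4 * k) ℤ.+ a                 ≡⟨ cong (ℤ._+ a) (g-4[2j+1] j) ⟩
  + 3 ℤ.* g k ℤ.- a ℤ.+ a         ≡⟨ cancel (g k) a ⟩
  + 3 ℤ.* g k ℤ.+ 0ℤ              ∎
  where
  open ≡-Reasoning
  k : ℕ
  a : ℤ
  k = 2 * j + 1
  a = tm (3 * k)
  cancel : ∀ x a → + 3 ℤ.* x ℤ.- a ℤ.+ a ≡ + 3 ℤ.* x ℤ.+ 0ℤ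
  cancel = ℤ-Solver.solve-∀
g-odd-block j (suc r) (s≤s r≤1) = begin
  g (4 * k + suc (suc r))
    ≡⟨ g-step _ (4 * k + suc r) (trans (+-suc (4 * k) (suc r)) (+-comm 1 _)) ⟩
  g (4 * k + suc r) ℤ.- tm (3 * (4 * k + suc r) + 1)
    ≡⟨ cong₂ ℤ._-_ (g-odd-block j r (m≤n⇒m≤1+n r≤1)) (tm-3[4k+r+1]+1 k r r≤1) ⟩
  + 3 ℤ.* g k ℤ.+ + r ℤ.* - b ℤ.- b
    ≡⟨ one-more (g k) b (+ r) ⟩
  + 3 ℤ.* g k ℤ.+ + suc r ℤ.* - b
    ∎
  where
  open ≡-Reasoning
  k : ℕ
  b : ℤ
  k = 2 * j + 1
  b = tm (3 * k + 1)
  one-more : ∀ x b ρ → + 3 ℤ.* x ℤ.+ ρ ℤ.* - b ℤ.- b ≡ + 3 ℤ.* x ℤ.+ (1ℤ ℤ.+ ρ) ℤ.* - b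
  one-more = ℤ-Solver.solve-∀

unit-or-zero : ∀ r {s} → s ≡ 1ℤ ⊎ r ≡ 0 → + r ℤ.* s ≡ + r
unit-or-zero r (inj₁ refl) = ℤ.*-identityʳ (+ r)
unit-or-zero 0 (inj₂ refl) = refl

rebase : ∀ x x′ s {r} → r ≤ 3 → x′ ≡ x ℤ.+ s →
         + 3 ℤ.* x ℤ.+ + r ℤ.* s ≡ + 3 ℤ.* x′ ℤ.+ + (3 ∸ r) ℤ.* - s
rebase x _ s {r} r≤3 refl = begin
  + 3 ℤ.* x ℤ.+ + r ℤ.* s                      ≡⟨ regroup x s (+ r) ⟩
  + 3 ℤ.* (x ℤ.+ s) ℤ.+ (+ 3 ℤ.- + r) ℤ.* - s  ≡⟨ cong (λ d → + 3 ℤ.* (x ℤ.+ s) ℤ.+ d ℤ.* - s) 3-r≡3∸r ⟩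
  + 3 ℤ.* (x ℤ.+ s) ℤ.+ + (3 ∸ r) ℤ.* - s      ∎
  where
  open ≡-Reasoning
  regroup : ∀ x s ρ → + 3 ℤ.* x ℤ.+ ρ ℤ.* s ≡ + 3 ℤ.* (x ℤ.+ s) ℤ.+ (+ 3 ℤ.- ρ) ℤ.* - s
  regroup = ℤ-Solver.solve-∀
  3-r≡3∸r : + 3 ℤ.- + r ≡ + (3 ∸ r)
  3-r≡3∸r = trans (ℤ.m-n≡m⊖n 3 r) (ℤ.⊖-≥ r≤3)

g-even-left : ∀ j r → r ≤ 3 → tm (3 * (2 * j)) ≡ 1ℤ ⊎ r ≡ 0 →
              g (4 * (2 * j) + r) ≡ + 3 ℤ.* g (2 * j) ℤ.+ + r
g-even-left j r r≤3 a≡1⊎r≡0 =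
  trans (g-even-block j r r≤3) (cong (λ d → + 3 ℤ.* g (2 * j) ℤ.+ d) (unit-or-zero r a≡1⊎r≡0))

g-even-right : ∀ j r → r ≤ 3 → tm (3 * (2 * j)) ≡ -1ℤ ⊎ r ≡ 3 →
               g (4 * (2 * j) + r) ≡ + 3 ℤ.* g (2 * j + 1) ℤ.+ + (3 ∸ r)
g-even-right j r r≤3 a≡-1⊎r≡3 = begin
  g (4 * (2 * j) + r)                          ≡⟨ g-even-block j r r≤3 ⟩
  + 3 ℤ.* g (2 * j) ℤ.+ + r ℤ.* a              ≡⟨ rebase (g (2 * j)) _ a r≤3 (g-next-even j) ⟩
  + 3 ℤ.* g (2 * j + 1) ℤ.+ + (3 ∸ r) ℤ.* - a  ≡⟨ cong (λ d → + 3 ℤ.* g (2 * j + 1) ℤ.+ d)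
                                                       (unit-or-zero (3 ∸ r) -a≡1⊎3∸r≡0) ⟩
  + 3 ℤ.* g (2 * j + 1) ℤ.+ + (3 ∸ r)          ∎
  where
  open ≡-Reasoning
  a : ℤ
  a = tm (3 * (2 * j))
  -a≡1⊎3∸r≡0 : - a ≡ 1ℤ ⊎ 3 ∸ r ≡ 0
  -a≡1⊎3∸r≡0 = Sum.map (cong -_) (cong (3 ∸_)) a≡-1⊎r≡3

g-odd-left : ∀ j r → r ≤ 2 → tm (3 * (2 * j + 1) + 1) ≡ -1ℤ ⊎ r ≡ 0 →
             g (4 * (2 * j + 1) + suc r) ≡ + 3 ℤ.* g (2 * j + 1) ℤ.+ + r
g-odd-left j r r≤2 b≡-1⊎r≡0 =
  trans (g-odd-block j r r≤2)
        (cong (λ d → + 3 ℤ.* g (2 * j + 1) ℤ.+ d) (unit-or-zero r (Sum.map₁ (cong -_) b≡-1⊎r≡0)))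

g-odd-right : ∀ j r → r ≤ 2 → tm (3 * (2 * j + 1) + 1) ≡ 1ℤ →
              g (4 * (2 * j + 1) + suc r) ≡ + 3 ℤ.* g (2 * j + 1 + 1) ℤ.+ + (3 ∸ r)
g-odd-right j r r≤2 b≡1 = begin
  g (4 * k + suc r)                               ≡⟨ g-odd-block j r r≤2 ⟩
  + 3 ℤ.* g k ℤ.+ + r ℤ.* - b                     ≡⟨ rebase (g k) _ (- b) (m≤n⇒m≤1+n r≤2) (g-next k) ⟩
  + 3 ℤ.* g (k + 1) ℤ.+ + (3 ∸ r) ℤ.* - - b       ≡⟨ cong (λ d → + 3 ℤ.* g (k + 1) ℤ.+ d)
                                                          (unit-or-zero (3 ∸ r) (inj₁ double-neg-b≡1)) ⟩
  + 3 ℤ.* g (k + 1) ℤ.+ + (3 ∸ r)                 ∎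
  where
  open ≡-Reasoning
  k : ℕ
  b : ℤ
  k = 2 * j + 1
  b = tm (3 * k + 1)
  double-neg-b≡1 : - - b ≡ 1ℤ
  double-neg-b≡1 = trans (ℤ.neg-involutive b) b≡1

g-odd-0 : ∀ j → tm (3 * (2 * j + 1)) ≡ -1ℤ → g (4 * (2 * j + 1) + 0) ≡ + 3 ℤ.* g (2 * j + 1) ℤ.+ + 1
g-odd-0 j a≡-1 = trans (cong g (+-identityʳ (4 * (2 * j + 1))))
                       (trans (g-4[2j+1] j) (cong (λ a → + 3 ℤ.* g (2 * j + 1) ℤ.- a) a≡-1))

g-odd-0-borrow : ∀ j k′ → tm (3 * (2 * j + 1)) ≡ 1ℤ → g (2 * j + 1) ≡ g k′ ℤ.+ 1ℤ →
                 g (4 * (2 * j + 1) + 0) ≡ + 3 ℤ.* g k′ ℤ.+ + 2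
g-odd-0-borrow j k′ a≡1 gk≡gk′+1 = begin
  g (4 * (2 * j + 1) + 0)                   ≡⟨ cong g (+-identityʳ (4 * (2 * j + 1))) ⟩
  g (4 * (2 * j + 1))                       ≡⟨ g-4[2j+1] j ⟩
  + 3 ℤ.* g (2 * j + 1) ℤ.- tm (3 * (2 * j + 1)) ≡⟨ cong₂ (λ x a → + 3 ℤ.* x ℤ.- a) gk≡gk′+1 a≡1 ⟩
  + 3 ℤ.* (g k′ ℤ.+ 1ℤ) ℤ.- 1ℤ               ≡⟨ borrow (g k′) ⟩
  + 3 ℤ.* g k′ ℤ.+ + 2                       ∎
  where
  open ≡-Reasoning
  borrow : ∀ x → + 3 ℤ.* (x ℤ.+ 1ℤ) ℤ.- 1ℤ ≡ + 3 ℤ.* x ℤ.+ + 2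
  borrow = ℤ-Solver.solve-∀

even-or-odd : ∀ n → ∃ λ m → n ≡ 2 * m ⊎ n ≡ 2 * m + 1
even-or-odd zero = 0 , inj₁ refl
even-or-odd (suc n) with even-or-odd n
... | m , inj₁ refl = m , inj₂ (+-comm 1 (2 * m))
... | m , inj₂ refl = suc m , inj₁ (ℕ-Solver.solve (m ∷ []))

±1≢- : ∀ {x} → x ≡ 1ℤ ⊎ x ≡ -1ℤ → x ≢ - x
±1≢- (inj₁ refl) ()
±1≢- (inj₂ refl) ()

tm-no-cube : ∀ n → tm n ≡ tm (n + 1) → tm (n + 2) ≡ - tm n
tm-no-cube n tm[n]≡tm[n+1] with even-or-odd n
... | m , inj₁ refl =
  contradiction (trans (sym (tm-2* m)) (trans tm[n]≡tm[n+1] (tm-2*+1 m))) (±1≢- (tm-±1 m))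
... | m , inj₂ refl = begin
  tm (2 * m + 1 + 2)    ≡⟨ tm-odd (2 * m + 1 + 2) (m + 1) (ℕ-Solver.solve (m ∷ [])) ⟩
  - tm (m + 1)          ≡⟨ cong -_ (tm-even (2 * m + 1 + 1) (m + 1) (ℕ-Solver.solve (m ∷ []))) ⟨
  - tm (2 * m + 1 + 1)  ≡⟨ cong -_ tm[n]≡tm[n+1] ⟨
  - tm (2 * m + 1)      ∎
  where open ≡-Reasoning

tm-3[2j+1]+1-forced : ∀ j → tm (3 * (2 * j + 1)) ≡ 1ℤ → tm (3 * (2 * j) + 1) ≡ 1ℤ →
                 tm (3 * (2 * j + 1) + 1) ≡ 1ℤ
tm-3[2j+1]+1-forced j a≡1 u≡1 = begin
  tm (3 * (2 * j + 1) + 1)  ≡⟨ tm-3[2j+1]+1 j ⟩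
  tm (3 * j + 2)            ≡⟨ tm-no-cube (3 * j) (trans tm[3j]≡-1 (sym tm[3j+1]≡-1)) ⟩
  - tm (3 * j)              ≡⟨ cong -_ tm[3j]≡-1 ⟩
  1ℤ                        ∎
  where
  open ≡-Reasoning
  tm[3j]≡-1 : tm (3 * j) ≡ -1ℤ
  tm[3j]≡-1 = trans (sym (ℤ.neg-involutive _)) (cong -_ (trans (sym (tm-3[2j]+1 j)) u≡1))
  tm[3j+1]≡-1 : tm (3 * j + 1) ≡ -1ℤ
  tm[3j+1]≡-1 = trans (sym (ℤ.neg-involutive _)) (cong -_ (trans (sym (tm-3[2j+1] j)) a≡1))

-- The extremal digit patterns

LowerTight : ℕ → Set
LowerTight n = In01Star0 (digits 4 n)

UpperTight : ℕ → Set
UpperTight n = digits 4 n ≡ 1 ∷ [] ⊎ In2Star3 (digits 4 n)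

In01Star0-parse : ∀ {ys} → In01Star0 ys → ∃ λ xs → ys ≡ xs ∷ʳ 0 × All (_< 2) xs
In01Star0-parse end0      = [] , refl , All.[]
In01Star0-parse (cons0 p) with In01Star0-parse p
... | xs , refl , bits = 0 ∷ xs , refl , s≤s z≤n All.∷ bits
In01Star0-parse (cons1 p) with In01Star0-parse p
... | xs , refl , bits = 1 ∷ xs , refl , s≤s (s≤s z≤n) All.∷ bits

In01Star0-∷ʳ0 : ∀ {xs} → All (_< 2) xs → In01Star0 (xs ∷ʳ 0)
In01Star0-∷ʳ0 All.[]                        = end0
In01Star0-∷ʳ0 {0 ∷ _}           (_ All.∷ bits)  = cons0 (In01Star0-∷ʳ0 bits)
In01Star0-∷ʳ0 {1 ∷ _}           (_ All.∷ bits)  = cons1 (In01Star0-∷ʳ0 bits)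
In01Star0-∷ʳ0 {suc (suc _) ∷ _} (s≤s (s≤s ()) All.∷ _)

In01Star0-∷ʳ : ∀ xs r → In01Star0 (xs ∷ʳ r) ⇔ (r ≡ 0 × All (_< 2) xs)
In01Star0-∷ʳ xs r = mk⇔ to from
  where
  to : In01Star0 (xs ∷ʳ r) → r ≡ 0 × All (_< 2) xs
  to p with In01Star0-parse p
  ... | ys , eq , bits with ∷ʳ-injective xs ys eq
  ... | refl , r≡0 = r≡0 , bits
  from : r ≡ 0 × All (_< 2) xs → In01Star0 (xs ∷ʳ r)
  from (refl , bits) = In01Star0-∷ʳ0 bits

In2Star3-parse : ∀ {ys} → In2Star3 ys → ∃ λ xs → ys ≡ xs ∷ʳ 3 × All (_≡ 2) xs
In2Star3-parse end3      = [] , refl , All.[]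
In2Star3-parse (cons2 p) with In2Star3-parse p
... | xs , refl , twos = 2 ∷ xs , refl , refl All.∷ twos

In2Star3-∷ʳ3 : ∀ {xs} → All (_≡ 2) xs → In2Star3 (xs ∷ʳ 3)
In2Star3-∷ʳ3 All.[]        = end3
In2Star3-∷ʳ3 (refl All.∷ twos) = cons2 (In2Star3-∷ʳ3 twos)

In2Star3-∷ʳ : ∀ xs r → In2Star3 (xs ∷ʳ r) ⇔ (r ≡ 3 × All (_≡ 2) xs)
In2Star3-∷ʳ xs r = mk⇔ to from
  where
  to : In2Star3 (xs ∷ʳ r) → r ≡ 3 × All (_≡ 2) xs
  to p with In2Star3-parse p
  ... | ys , eq , twos with ∷ʳ-injective xs ys eq
  ... | refl , r≡3 = r≡3 , twos
  from : r ≡ 3 × All (_≡ 2) xs → In2Star3 (xs ∷ʳ r)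
  from (refl , twos) = In2Star3-∷ʳ3 twos

digits-≡[] : ∀ c .{{_ : NonZero c}} → 1 < c → ∀ n → digits c n ≡ [] → n ≡ 0
digits-≡[] c 1<c zero      _  = refl
digits-≡[] c 1<c n@(suc _) eq
  with ++-conicalʳ (digits c (n / c)) (n % c ∷ []) (trans (sym (digits-step c 1<c n (s≤s z≤n))) eq)
... | ()

digits₄-∷ʳ : ∀ q {r} → r < 4 → 0 < 4 * q + r → digits 4 (4 * q + r) ≡ digits 4 q ∷ʳ r
digits₄-∷ʳ = digits-∷ʳ 4 (s≤s (s≤s z≤n))

lowerTight-4q+r : ∀ q {r} → r < 4 → 0 < 4 * q + r → LowerTight (4 * q + r) ⇔ (r ≡ 0 × All (_< 2) (digits 4 q))
lowerTight-4q+r q {r} r<4 0<n =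
  subst (λ ds → In01Star0 ds ⇔ (r ≡ 0 × All (_< 2) (digits 4 q))) (sym (digits₄-∷ʳ q r<4 0<n))
        (In01Star0-∷ʳ (digits 4 q) r)

upperTight-4q+r : ∀ q {r} → r < 4 → 0 < 4 * q + r →
                  UpperTight (4 * q + r) ⇔ ((q ≡ 0 × r ≡ 1) ⊎ (r ≡ 3 × All (_≡ 2) (digits 4 q)))
upperTight-4q+r q {r} r<4 0<n =
  subst (λ ds → (ds ≡ 1 ∷ [] ⊎ In2Star3 ds) ⇔ ((q ≡ 0 × r ≡ 1) ⊎ (r ≡ 3 × All (_≡ 2) (digits 4 q))))
        (sym (digits₄-∷ʳ q r<4 0<n)) (single ⊎-⇔ In2Star3-∷ʳ (digits 4 q) r)
  where
  single : (digits 4 q ∷ʳ r ≡ 1 ∷ []) ⇔ (q ≡ 0 × r ≡ 1)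
  single = mk⇔ to from
    where
    to : digits 4 q ∷ʳ r ≡ 1 ∷ [] → q ≡ 0 × r ≡ 1
    to eq with ∷ʳ-injective (digits 4 q) [] eq
    ... | ds≡[] , r≡1 = digits-≡[] 4 (s≤s (s≤s z≤n)) q ds≡[] , r≡1
    from : q ≡ 0 × r ≡ 1 → digits 4 q ∷ʳ r ≡ 1 ∷ []
    from (refl , refl) = refl

binary-4q+r : ∀ q {r} → r < 4 → 0 < 4 * q + r →
              All (_< 2) (digits 4 (4 * q + r)) ⇔ (r < 2 × All (_< 2) (digits 4 q))
binary-4q+r q {r} r<4 0<n =
  subst (λ ds → All (_< 2) ds ⇔ (r < 2 × All (_< 2) (digits 4 q))) (sym (digits₄-∷ʳ q r<4 0<n))
  (mk⇔ (λ bits → let (bq , br) = ∷ʳ⁻ bits in br , bq) (λ (br , bq) → ∷ʳ⁺ bq br))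

twos-4q+r : ∀ q {r} → r < 4 → 0 < 4 * q + r →
            All (_≡ 2) (digits 4 (4 * q + r)) ⇔ (r ≡ 2 × All (_≡ 2) (digits 4 q))
twos-4q+r q {r} r<4 0<n =
  subst (λ ds → All (_≡ 2) ds ⇔ (r ≡ 2 × All (_≡ 2) (digits 4 q))) (sym (digits₄-∷ʳ q r<4 0<n))
  (mk⇔ (λ twos → let (tq , tr) = ∷ʳ⁻ twos in tr , tq) (λ (tr , tq) → ∷ʳ⁺ tq tr))

0<r⇒0<4q+r : ∀ q {r} → 0 < r → 0 < 4 * q + r
0<r⇒0<4q+r q {r} 0<r = ≤-trans 0<r (m≤n+m r (4 * q))

0<q⇒0<4q+r : ∀ {q} r → 0 < q → 0 < 4 * q + r
0<q⇒0<4q+r {q} r 0<q = ≤-trans (≤-trans 0<q (m≤n*m q 4)) (m≤m+n (4 * q) r)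

¬lowerTight-4q+r : ∀ q {r} → 0 < r → r < 4 → ¬ LowerTight (4 * q + r)
¬lowerTight-4q+r q {suc _} 0<r r<4 tight with Equivalence.to (lowerTight-4q+r q r<4 (0<r⇒0<4q+r q 0<r)) tight
... | () , _

¬upperTight-4q+r : ∀ q {r} → 0 < q → r < 3 → ¬ UpperTight (4 * q + r)
¬upperTight-4q+r q {r} 0<q r<3 tight
  with Equivalence.to (upperTight-4q+r q (m≤n⇒m≤1+n r<3) (0<q⇒0<4q+r r 0<q)) tight
... | inj₁ (refl , _) = contradiction 0<q λ ()
... | inj₂ (refl , _) = contradiction r<3 λ { (s≤s (s≤s (s≤s ()))) }

refuted-⇔ : ∀ {A B : Set} → ¬ A → ¬ B → A ⇔ B
refuted-⇔ ¬A ¬B = mk⇔ (λ a → contradiction a ¬A) (λ b → contradiction b ¬B)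

lowerTight-4q : ∀ q → 0 < q → LowerTight (4 * q + 0) ⇔ All (_< 2) (digits 4 q)
lowerTight-4q q 0<q = ⇔-trans (lowerTight-4q+r q (s≤s z≤n) (0<q⇒0<4q+r 0 0<q)) (mk⇔ proj₂ (refl ,_))

binary-4q+r<2 : ∀ q {r} → r < 2 → 0 < 4 * q + r → All (_< 2) (digits 4 (4 * q + r)) ⇔ All (_< 2) (digits 4 q)
binary-4q+r<2 q r<2 0<n = ⇔-trans (binary-4q+r q (≤-trans r<2 (s≤s (s≤s z≤n))) 0<n) (mk⇔ proj₂ (r<2 ,_))

¬binary-4q+r : ∀ q {r} → 2 ≤ r → r < 4 → ¬ All (_< 2) (digits 4 (4 * q + r))
¬binary-4q+r q 2≤r r<4 bits =
  <⇒≱ (proj₁ (Equivalence.to (binary-4q+r q r<4 (0<r⇒0<4q+r q (≤-trans (s≤s z≤n) 2≤r))) bits)) 2≤r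

0<2m⇒0<m : ∀ {m} → 0 < 2 * m → 0 < m
0<2m⇒0<m {zero}  ()
0<2m⇒0<m {suc _} _ = s≤s z≤n

binary⇔lowerTight-2j : ∀ j → 0 < j → All (_< 2) (digits 4 (2 * j)) ⇔ LowerTight (2 * j)
binary⇔lowerTight-2j j 0<j with even-or-odd j
... | i , inj₁ refl = subst (λ n → All (_< 2) (digits 4 n) ⇔ LowerTight n) (4i≡2[2i] i)
  (⇔-trans (binary-4q+r<2 i (s≤s z≤n) 0<4i) (⇔-sym (lowerTight-4q i 0<i)))
  where
  0<i : 0 < i
  0<i = 0<2m⇒0<m 0<j
  0<4i : 0 < 4 * i + 0
  0<4i = 0<q⇒0<4q+r 0 0<i
  4i≡2[2i] : ∀ i → 4 * i + 0 ≡ 2 * (2 * i)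
  4i≡2[2i] = ℕ-Solver.solve-∀
... | i , inj₂ refl = subst (λ n → All (_< 2) (digits 4 n) ⇔ LowerTight n) (4i+2≡2[2i+1] i)
  (refuted-⇔ (¬binary-4q+r i ≤-refl (s≤s (s≤s (s≤s z≤n))))
             (¬lowerTight-4q+r i (s≤s z≤n) (s≤s (s≤s (s≤s z≤n)))))
  where
  4i+2≡2[2i+1] : ∀ i → 4 * i + 2 ≡ 2 * (2 * i + 1)
  4i+2≡2[2i+1] = ℕ-Solver.solve-∀

binary⇔lowerTight-2j+1 : ∀ j → 0 < j → All (_< 2) (digits 4 (2 * j + 1)) ⇔ LowerTight (2 * j)
binary⇔lowerTight-2j+1 j 0<j with even-or-odd j
... | i , inj₁ refl =
  subst₂ (λ n m → All (_< 2) (digits 4 n) ⇔ LowerTight m) (4i+1≡2[2i]+1 i) (4i≡2[2i] i)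
  (⇔-trans (binary-4q+r<2 i (s≤s (s≤s z≤n)) (0<r⇒0<4q+r i (s≤s z≤n)))
           (⇔-sym (lowerTight-4q i (0<2m⇒0<m 0<j))))
  where
  4i+1≡2[2i]+1 : ∀ i → 4 * i + 1 ≡ 2 * (2 * i) + 1
  4i+1≡2[2i]+1 = ℕ-Solver.solve-∀
  4i≡2[2i] : ∀ i → 4 * i + 0 ≡ 2 * (2 * i)
  4i≡2[2i] = ℕ-Solver.solve-∀
... | i , inj₂ refl =
  subst₂ (λ n m → All (_< 2) (digits 4 n) ⇔ LowerTight m) (4i+3≡2[2i+1]+1 i) (4i+2≡2[2i+1] i)
    (refuted-⇔ (¬binary-4q+r i (s≤s (s≤s z≤n)) ≤-refl)
               (¬lowerTight-4q+r i (s≤s z≤n) (s≤s (s≤s (s≤s z≤n)))))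
  where
  4i+3≡2[2i+1]+1 : ∀ i → 4 * i + 3 ≡ 2 * (2 * i + 1) + 1
  4i+3≡2[2i+1]+1 = ℕ-Solver.solve-∀
  4i+2≡2[2i+1] : ∀ i → 4 * i + 2 ≡ 2 * (2 * i + 1)
  4i+2≡2[2i+1] = ℕ-Solver.solve-∀

lowerTight-4[2j] : ∀ j → 0 < j → LowerTight (4 * (2 * j) + 0) ⇔ LowerTight (2 * j)
lowerTight-4[2j] j 0<j = ⇔-trans (lowerTight-4q (2 * j) (≤-trans 0<j (m≤n*m j 2))) (binary⇔lowerTight-2j j 0<j)

lowerTight-4[2j+1] : ∀ j → 0 < j → LowerTight (4 * (2 * j + 1) + 0) ⇔ LowerTight (2 * j)
lowerTight-4[2j+1] j 0<j = ⇔-trans (lowerTight-4q (2 * j + 1) (m≤n+m 1 (2 * j))) (binary⇔lowerTight-2j+1 j 0<j)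

upperTight-4k+3 : ∀ k → UpperTight (4 * k + 3) ⇔ All (_≡ 2) (digits 4 k)
upperTight-4k+3 k = ⇔-trans (upperTight-4q+r k ≤-refl (0<r⇒0<4q+r k (s≤s z≤n)))
  (mk⇔ (λ { (inj₁ (_ , ())) ; (inj₂ (_ , twos)) → twos }) (λ twos → inj₂ (refl , twos)))

¬twos-4q+r : ∀ q {r} → r ≢ 2 → r < 4 → 0 < 4 * q + r → ¬ All (_≡ 2) (digits 4 (4 * q + r))
¬twos-4q+r q r≢2 r<4 0<n twos = r≢2 (proj₁ (Equivalence.to (twos-4q+r q r<4 0<n) twos))

upperTight-suc : ∀ k → UpperTight (k + 1) ⇔ All (_≡ 2) (digits 4 k)
upperTight-suc k with divide 4 k
... | zero      , zero , _ , refl = mk⇔ (λ _ → All.[]) (λ _ → inj₁ refl)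
... | q@(suc _) , zero , _ , refl =
  subst (λ n → UpperTight n ⇔ All (_≡ 2) (digits 4 (4 * q + 0))) (sym (+-assoc (4 * q) 0 1))
    (refuted-⇔ (¬upperTight-4q+r q (s≤s z≤n) (s≤s (s≤s z≤n)))
               (¬twos-4q+r q (λ ()) (s≤s z≤n) (0<q⇒0<4q+r 0 (s≤s z≤n))))
... | q , 1 , _ , refl =
  subst (λ n → UpperTight n ⇔ All (_≡ 2) (digits 4 (4 * q + 1))) (sym (+-assoc (4 * q) 1 1))
    (refuted-⇔ ¬upperTight-4q+2 (¬twos-4q+r q (λ ()) (s≤s (s≤s z≤n)) (0<r⇒0<4q+r q (s≤s z≤n))))
  where
  ¬upperTight-4q+2 : ¬ UpperTight (4 * q + 2)
  ¬upperTight-4q+2 tight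
    with Equivalence.to (upperTight-4q+r q (s≤s (s≤s (s≤s z≤n))) (0<r⇒0<4q+r q (s≤s z≤n))) tight
  ... | inj₁ (_ , ())
  ... | inj₂ (() , _)
... | q , 2 , _ , refl =
  subst (λ n → UpperTight n ⇔ All (_≡ 2) (digits 4 (4 * q + 2))) (sym (+-assoc (4 * q) 2 1))
    (⇔-trans (upperTight-4k+3 q)
             (⇔-sym (⇔-trans (twos-4q+r q (s≤s (s≤s (s≤s z≤n))) (0<r⇒0<4q+r q (s≤s z≤n))) (mk⇔ proj₂ (refl ,_)))))
... | q , 3 , _ , refl =
  subst (λ n → UpperTight n ⇔ All (_≡ 2) (digits 4 (4 * q + 3))) (4[q+1]≡4q+3+1 q)
    (refuted-⇔ (¬upperTight-4q+r (suc q) (s≤s z≤n) (s≤s z≤n))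
               (¬twos-4q+r q (λ ()) ≤-refl (0<r⇒0<4q+r q (s≤s z≤n))))
  where
  4[q+1]≡4q+3+1 : ∀ q → 4 * suc q + 0 ≡ 4 * q + 3 + 1
  4[q+1]≡4q+3+1 = ℕ-Solver.solve-∀
... | _ , suc (suc (suc (suc _))) , s≤s (s≤s (s≤s (s≤s ()))) , _

upperTight-4k+3⇔k+1 : ∀ k → UpperTight (4 * k + 3) ⇔ UpperTight (k + 1)
upperTight-4k+3⇔k+1 k = ⇔-trans (upperTight-4k+3 k) (⇔-sym (upperTight-suc k))

¬twos-2j+1 : ∀ j → ¬ All (_≡ 2) (digits 4 (2 * j + 1))
¬twos-2j+1 j with even-or-odd j
... | i , inj₁ refl = subst (λ n → ¬ All (_≡ 2) (digits 4 n)) (4i+1≡2[2i]+1 i)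
  (¬twos-4q+r i (λ ()) (s≤s (s≤s z≤n)) (0<r⇒0<4q+r i (s≤s z≤n)))
  where
  4i+1≡2[2i]+1 : ∀ i → 4 * i + 1 ≡ 2 * (2 * i) + 1
  4i+1≡2[2i]+1 = ℕ-Solver.solve-∀
... | i , inj₂ refl = subst (λ n → ¬ All (_≡ 2) (digits 4 n)) (4i+3≡2[2i+1]+1 i)
  (¬twos-4q+r i (λ ()) ≤-refl (0<r⇒0<4q+r i (s≤s z≤n)))
  where
  4i+3≡2[2i+1]+1 : ∀ i → 4 * i + 3 ≡ 2 * (2 * i + 1) + 1
  4i+3≡2[2i+1]+1 = ℕ-Solver.solve-∀

¬upperTight-4[2j+1]+3 : ∀ j → ¬ UpperTight (4 * (2 * j + 1) + 3)
¬upperTight-4[2j+1]+3 j tight = ¬twos-2j+1 j (Equivalence.to (upperTight-4k+3 (2 * j + 1)) tight)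


¬upperTight-4[2j+1]+r : ∀ j {r} → r < 4 → ¬ UpperTight (4 * (2 * j + 1) + r)
¬upperTight-4[2j+1]+r j {3} _ = ¬upperTight-4[2j+1]+3 j
¬upperTight-4[2j+1]+r j {0} _ = ¬upperTight-4q+r (2 * j + 1) (m≤n+m 1 (2 * j)) (s≤s z≤n)
¬upperTight-4[2j+1]+r j {1} _ = ¬upperTight-4q+r (2 * j + 1) (m≤n+m 1 (2 * j)) (s≤s (s≤s z≤n))
¬upperTight-4[2j+1]+r j {2} _ = ¬upperTight-4q+r (2 * j + 1) (m≤n+m 1 (2 * j)) (s≤s (s≤s (s≤s z≤n)))
¬upperTight-4[2j+1]+r j {suc (suc (suc (suc _)))} (s≤s (s≤s (s≤s (s≤s ()))))

tm-3*binary : ∀ k → All (_< 2) (digits 4 k) → tm (3 * k) ≡ 1ℤ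
tm-3*binary = base-induction 4 (s≤s (s≤s z≤n)) (λ k → All (_< 2) (digits 4 k) → tm (3 * k) ≡ 1ℤ)
                             (λ _ → refl) step
  where
  open ≡-Reasoning
  last-digit : ∀ q r → r < 2 → tm (3 * q) ≡ 1ℤ → tm (3 * (4 * q + r)) ≡ 1ℤ
  last-digit q 0 _ tm[3q]≡1 = begin
    tm (3 * (4 * q + 0))  ≡⟨ tm-even (3 * (4 * q + 0)) (3 * (2 * q)) (ℕ-Solver.solve (q ∷ [])) ⟩
    tm (3 * (2 * q))      ≡⟨ tm-3[2j] q ⟩
    tm (3 * q)            ≡⟨ tm[3q]≡1 ⟩
    1ℤ                    ∎
  last-digit q 1 _ tm[3q]≡1 = begin
    tm (3 * (4 * q + 1))    ≡⟨ tm-odd (3 * (4 * q + 1)) (3 * (2 * q) + 1) (ℕ-Solver.solve (q ∷ [])) ⟩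
    - tm (3 * (2 * q) + 1)  ≡⟨ cong -_ (tm-3[2j]+1 q) ⟩
    - - tm (3 * q)          ≡⟨ ℤ.neg-involutive _ ⟩
    tm (3 * q)              ≡⟨ tm[3q]≡1 ⟩
    1ℤ                      ∎
  last-digit q (suc (suc _)) (s≤s (s≤s ())) _
  step : ∀ q {r} → r < 4 → 0 < 4 * q + r → (All (_< 2) (digits 4 q) → tm (3 * q) ≡ 1ℤ) →
         All (_< 2) (digits 4 (4 * q + r)) → tm (3 * (4 * q + r)) ≡ 1ℤ
  step q {r} r<4 0<n ih bits = last-digit q r (proj₁ split) (ih (proj₂ split))
    where
    split : r < 2 × All (_< 2) (digits 4 q)
    split = Equivalence.to (binary-4q+r q r<4 0<n) bits

-- The linear bounds

record Bounds (n w : ℕ) : Set where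
  field
    lower       : n ≤ 2 * w
    upper       : 2 * w + 1 ≤ 3 * n
    lower-tight : n ≡ 2 * w ⇔ LowerTight n
    upper-tight : 2 * w + 1 ≡ 3 * n ⇔ UpperTight n

strict-bounds : ∀ {n w} → n < 2 * w → 2 * w + 1 < 3 * n → ¬ LowerTight n → ¬ UpperTight n → Bounds n w
strict-bounds lo up ¬lt ¬ut = record
  { lower       = <⇒≤ lo
  ; upper       = <⇒≤ up
  ; lower-tight = refuted-⇔ (<⇒≢ lo) ¬lt
  ; upper-tight = refuted-⇔ (<⇒≢ up) ¬ut
  }

below-digit : ∀ k w r d → k ≤ 2 * w → r ≤ d → 0 < d → 4 * k + r < 2 * (4 * w + d)
below-digit k w r d k≤2w r≤d 0<d = begin-strict
  4 * k + r            ≤⟨ +-monoʳ-≤ (4 * k) r≤d ⟩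
  4 * k + d            <⟨ +-monoʳ-< (4 * k) (m<m+n d 0<d) ⟩
  4 * k + (d + d)      ≤⟨ +-monoˡ-≤ (d + d) (*-monoʳ-≤ 4 k≤2w) ⟩
  4 * (2 * w) + (d + d) ≡⟨ ℕ-Solver.solve (w ∷ d ∷ []) ⟩
  2 * (4 * w + d)      ∎
  where open ≤-Reasoning

below-carry : ∀ k w r d → k < 2 * w → r < 4 → 4 * k + r < 2 * (4 * w + d)
below-carry k w r d k<2w r<4 = begin-strict
  4 * k + r        <⟨ +-monoʳ-< (4 * k) r<4 ⟩
  4 * k + 4        ≡⟨ ℕ-Solver.solve (k ∷ []) ⟩
  4 * suc k        ≤⟨ *-monoʳ-≤ 4 k<2w ⟩
  4 * (2 * w)      ≤⟨ m≤m+n (4 * (2 * w)) (2 * d) ⟩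
  4 * (2 * w) + 2 * d ≡⟨ ℕ-Solver.solve (w ∷ d ∷ []) ⟩
  2 * (4 * w + d)  ∎
  where open ≤-Reasoning

above-digit : ∀ k w r d → 2 * w + 1 ≤ 3 * k → d ≤ suc r → 2 * (4 * w + d) + 1 < 3 * (4 * k + r)
above-digit k w r d 2w+1≤3k d≤1+r = +-cancelʳ-≤ 2 _ _ (begin
  suc (2 * (4 * w + d) + 1) + 2  ≡⟨ ℕ-Solver.solve (w ∷ d ∷ []) ⟩
  4 * (2 * w + 1) + 2 * d        ≤⟨ +-monoˡ-≤ (2 * d) (*-monoʳ-≤ 4 2w+1≤3k) ⟩
  4 * (3 * k) + 2 * d            ≤⟨ +-monoʳ-≤ (4 * (3 * k)) (*-monoʳ-≤ 2 d≤1+r) ⟩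
  4 * (3 * k) + 2 * suc r        ≡⟨ ℕ-Solver.solve (k ∷ r ∷ []) ⟩
  4 * (3 * k) + 2 * r + 2        ≤⟨ +-monoˡ-≤ 2 (+-monoʳ-≤ (4 * (3 * k)) (*-monoˡ-≤ r (n≤1+n 2))) ⟩
  4 * (3 * k) + 3 * r + 2        ≡⟨ ℕ-Solver.solve (k ∷ r ∷ []) ⟩
  3 * (4 * k + r) + 2            ∎)
  where open ≤-Reasoning

above-carry : ∀ k w w′ r d → w′ < w → 2 * w + 1 ≤ 3 * k → d ≤ 2 → 2 * (4 * w′ + d) + 1 < 3 * (4 * k + r)
above-carry k w w′ r d w′<w 2w+1≤3k d≤2 = begin-strict
  2 * (4 * w′ + d) + 1  <⟨ +-monoˡ-< 1 (*-monoʳ-< 2 4w′+d<4w) ⟩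
  2 * (4 * w + 0) + 1   <⟨ above-digit k w 0 0 2w+1≤3k z≤n ⟩
  3 * (4 * k + 0)       ≤⟨ *-monoʳ-≤ 3 (+-monoʳ-≤ (4 * k) z≤n) ⟩
  3 * (4 * k + r)       ∎
  where
  open ≤-Reasoning
  4w′+d<4w : 4 * w′ + d < 4 * w + 0
  4w′+d<4w = begin-strict
    4 * w′ + d     <⟨ +-monoʳ-< (4 * w′) (s≤s (m≤n⇒m≤1+n d≤2)) ⟩
    4 * w′ + 4     ≡⟨ ℕ-Solver.solve (w′ ∷ []) ⟩
    4 * suc w′     ≤⟨ *-monoʳ-≤ 4 w′<w ⟩
    4 * w          ≡⟨ +-identityʳ (4 * w) ⟨
    4 * w + 0      ∎

affine-≡-⇔ : ∀ {a b} m .{{_ : NonZero m}} x y c → a ≡ m * x + c → b ≡ m * y + c → (a ≡ b) ⇔ (x ≡ y)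
affine-≡-⇔ m x y c refl refl =
  mk⇔ (λ eq → *-cancelˡ-≡ x y m (+-cancelʳ-≡ c (m * x) (m * y) eq)) (cong (λ z → m * z + c))

bounds-4k : ∀ {k w} → 0 < k → Bounds k w → (LowerTight (4 * k + 0) ⇔ LowerTight k) →
            Bounds (4 * k + 0) (4 * w + 0)
bounds-4k {k} {w} 0<k B lt⇔ = record
  { lower       = subst (4 * k + 0 ≤_) (4[2w]+0≡2[4w+0] w) (+-monoˡ-≤ 0 (*-monoʳ-≤ 4 (Bounds.lower B)))
  ; upper       = <⇒≤ up
  ; lower-tight = ⇔-trans (affine-≡-⇔ 4 k (2 * w) 0 refl (sym (4[2w]+0≡2[4w+0] w)))
                          (⇔-trans (Bounds.lower-tight B) (⇔-sym lt⇔))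
  ; upper-tight = refuted-⇔ (<⇒≢ up) (¬upperTight-4q+r k 0<k (s≤s z≤n))
  }
  where
  up : 2 * (4 * w + 0) + 1 < 3 * (4 * k + 0)
  up = above-digit k w 0 0 (Bounds.upper B) z≤n
  4[2w]+0≡2[4w+0] : ∀ w → 4 * (2 * w) + 0 ≡ 2 * (4 * w + 0)
  4[2w]+0≡2[4w+0] = ℕ-Solver.solve-∀

bounds-4k+3 : ∀ {k w} → Bounds (k + 1) w → Bounds (4 * k + 3) (4 * w + 0)
bounds-4k+3 {k} {w} B = record
  { lower       = <⇒≤ lo
  ; upper       = +-cancelʳ-≤ 3 _ _ (begin
      2 * (4 * w + 0) + 1 + 3  ≡⟨ ℕ-Solver.solve (w ∷ []) ⟩
      4 * (2 * w + 1)          ≤⟨ *-monoʳ-≤ 4 (Bounds.upper B) ⟩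
      4 * (3 * (k + 1))        ≡⟨ ℕ-Solver.solve (k ∷ []) ⟩
      3 * (4 * k + 3) + 3      ∎)
  ; lower-tight = refuted-⇔ (<⇒≢ lo) (¬lowerTight-4q+r k (s≤s z≤n) ≤-refl)
  ; upper-tight = ⇔-trans (affine-≡-⇔ 4 (2 * w) (3 * k + 2) 1 (times-4 w) (times-4′ k))
                          (⇔-trans (⇔-sym (affine-≡-⇔ 1 (2 * w) (3 * k + 2) 1 (times-1 w) (times-1′ k)))
                                   (⇔-trans (Bounds.upper-tight B) (⇔-sym (upperTight-4k+3⇔k+1 k))))
  }
  where
  open ≤-Reasoning
  lo : 4 * k + 3 < 2 * (4 * w + 0)
  lo = below-carry k w 3 0 (subst (_≤ 2 * w) (+-comm k 1) (Bounds.lower B)) ≤-refl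
  times-4 : ∀ w → 2 * (4 * w + 0) + 1 ≡ 4 * (2 * w) + 1
  times-4 = ℕ-Solver.solve-∀
  times-4′ : ∀ k → 3 * (4 * k + 3) ≡ 4 * (3 * k + 2) + 1
  times-4′ = ℕ-Solver.solve-∀
  times-1 : ∀ w → 2 * w + 1 ≡ 1 * (2 * w) + 1
  times-1 = ℕ-Solver.solve-∀
  times-1′ : ∀ k → 3 * (k + 1) ≡ 1 * (3 * k + 2) + 1
  times-1′ = ℕ-Solver.solve-∀

bounds-borrow : ∀ {j w₀ w} → 0 < j → Bounds (2 * j) w₀ → w₀ < w → Bounds (2 * j + 1) w →
                Bounds (4 * (2 * j + 1) + 0) (4 * w₀ + 2)
bounds-borrow {j} {w₀} {w} 0<j B₀ w₀<w B = record
  { lower       = subst₂ _≤_ (sym (4[x+1]+0≡4x+4 (2 * j))) (sym (2[4x+2]≡4[2x]+4 w₀))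
                         (+-monoˡ-≤ 4 (*-monoʳ-≤ 4 (Bounds.lower B₀)))
  ; upper       = <⇒≤ up
  ; lower-tight = ⇔-trans (affine-≡-⇔ 4 (2 * j) (2 * w₀) 4 (4[x+1]+0≡4x+4 (2 * j)) (2[4x+2]≡4[2x]+4 w₀))
                          (⇔-trans (Bounds.lower-tight B₀) (⇔-sym (lowerTight-4[2j+1] j 0<j)))
  ; upper-tight = refuted-⇔ (<⇒≢ up) (¬upperTight-4q+r (2 * j + 1) (m≤n+m 1 (2 * j)) (s≤s z≤n))
  }
  where
  up : 2 * (4 * w₀ + 2) + 1 < 3 * (4 * (2 * j + 1) + 0)
  up = above-carry (2 * j + 1) w w₀ 0 2 w₀<w (Bounds.upper B) ≤-refl
  4[x+1]+0≡4x+4 : ∀ x → 4 * (x + 1) + 0 ≡ 4 * x + 4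
  4[x+1]+0≡4x+4 = ℕ-Solver.solve-∀
  2[4x+2]≡4[2x]+4 : ∀ x → 2 * (4 * x + 2) ≡ 4 * (2 * x) + 4
  2[4x+2]≡4[2x]+4 = ℕ-Solver.solve-∀

record Bounded (n : ℕ) : Set where
  field
    value   : ℕ
    g≡value : g n ≡ + value
    bounds  : Bounds n (p34 value)

open Bounded

digit-step : ∀ {n k} (B : Bounded k) {d} → d < 3 → g n ≡ + 3 ℤ.* g k ℤ.+ + d →
             Bounds n (4 * p34 (value B) + d) → Bounded n
digit-step {n} {k} B {d} d<3 gn≡3gk+d bounds-n = record
  { value   = 3 * value B + d
  ; g≡value = begin
      g n                           ≡⟨ gn≡3gk+d ⟩
      + 3 ℤ.* g k ℤ.+ + d           ≡⟨ cong (λ x → + 3 ℤ.* x ℤ.+ + d) (g≡value B) ⟩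
      + 3 ℤ.* + value B ℤ.+ + d     ≡⟨ cong (ℤ._+ + d) (ℤ.pos-* 3 (value B)) ⟨
      + (3 * value B + d)           ∎
  ; bounds  = subst (Bounds n) (sym (p34-step (value B) d<3)) bounds-n
  }
  where open ≡-Reasoning

p34-value-< : ∀ {k k′} (B : Bounded k) (B′ : Bounded k′) → g k ≡ g k′ ℤ.+ 1ℤ →
              p34 (value B′) < p34 (value B)
p34-value-< B B′ gk≡gk′+1 = subst (λ y → p34 (value B′) < p34 y) (sym value≡1+value′) (p34-<-suc (value B′))
  where
  value≡1+value′ : value B ≡ suc (value B′)
  value≡1+value′ =
    trans (ℤ.+-injective (trans (sym (g≡value B)) (trans gk≡gk′+1 (cong (ℤ._+ 1ℤ) (g≡value B′)))))
          (+-comm (value B′) 1)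

x′≡x-1⇒x≡x′+1 : ∀ {x x′} → x′ ≡ x ℤ.+ -1ℤ → x ≡ x′ ℤ.+ 1ℤ
x′≡x-1⇒x≡x′+1 {x} refl = cancel x
  where
  cancel : ∀ x → x ≡ x ℤ.+ -1ℤ ℤ.+ 1ℤ
  cancel = ℤ-Solver.solve-∀

bounded-<8 : ∀ n → 0 < n → n < 8 → Bounded n
bounded-<8 1 _ _ = record { value = 1 ; g≡value = refl ; bounds = record
  { lower = from-yes (1 ≤? 2) ; upper = ≤-refl
  ; lower-tight = refuted-⇔ (λ ()) (λ { (cons1 ()) })
  ; upper-tight = mk⇔ (λ _ → inj₁ refl) (λ _ → refl) } }
bounded-<8 2 _ _ = record { value = 2 ; g≡value = refl ; bounds =
  strict-bounds (from-yes (2 <? 4)) (from-yes (5 <? 6)) (λ ()) (λ { (inj₁ ()) ; (inj₂ (cons2 ())) }) }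
bounded-<8 3 _ _ = record { value = 3 ; g≡value = refl ; bounds = record
  { lower = from-yes (3 ≤? 8) ; upper = ≤-refl
  ; lower-tight = refuted-⇔ (λ ()) (λ ())
  ; upper-tight = mk⇔ (λ _ → inj₂ end3) (λ _ → refl) } }
bounded-<8 4 _ _ = record { value = 2 ; g≡value = refl ; bounds = record
  { lower = ≤-refl ; upper = from-yes (5 ≤? 12)
  ; lower-tight = mk⇔ (λ _ → cons1 end0) (λ _ → refl)
  ; upper-tight = refuted-⇔ (λ ()) (λ { (inj₁ ()) ; (inj₂ ()) }) } }
bounded-<8 5 _ _ = record { value = 3 ; g≡value = refl ; bounds =
  strict-bounds (from-yes (5 <? 8)) (from-yes (9 <? 15)) (λ { (cons1 (cons1 ())) }) (λ { (inj₁ ()) ; (inj₂ ()) }) }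
bounded-<8 6 _ _ = record { value = 4 ; g≡value = refl ; bounds =
  strict-bounds (from-yes (6 <? 10)) (from-yes (11 <? 18)) (λ { (cons1 ()) }) (λ { (inj₁ ()) ; (inj₂ ()) }) }
bounded-<8 7 _ _ = record { value = 5 ; g≡value = refl ; bounds =
  strict-bounds (from-yes (7 <? 12)) (from-yes (13 <? 21)) (λ { (cons1 ()) }) (λ { (inj₁ ()) ; (inj₂ ()) }) }
bounded-<8 (suc (suc (suc (suc (suc (suc (suc (suc _))))))))
           _ (s≤s (s≤s (s≤s (s≤s (s≤s (s≤s (s≤s (s≤s ()))))))))

bounds-same : ∀ {k w} r d → Bounds k w → 4 * k + r < 2 * (4 * w + d) → d ≤ suc r →
              ¬ LowerTight (4 * k + r) → ¬ UpperTight (4 * k + r) → Bounds (4 * k + r) (4 * w + d)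
bounds-same {k} {w} r d B lo d≤1+r = strict-bounds lo (above-digit k w r d (Bounds.upper B) d≤1+r)

bounds-carry : ∀ {k w w₁} r d → Bounds k w → Bounds (k + 1) w₁ → w₁ < w → r < 4 → d ≤ 2 →
               ¬ LowerTight (4 * k + r) → ¬ UpperTight (4 * k + r) → Bounds (4 * k + r) (4 * w₁ + d)
bounds-carry {k} {w} {w₁} r d B B₁ w₁<w r<4 d≤2 =
  strict-bounds (below-carry k w₁ r d (subst (_≤ 2 * w₁) (+-comm k 1) (Bounds.lower B₁)) r<4)
         (above-carry k w w₁ r d w₁<w (Bounds.upper B) d≤2)

even-middle : ∀ j r → 0 < j → r < 2 → Bounded (2 * j) → Bounded (2 * j + 1) → Bounded (4 * (2 * j) + suc r)
even-middle j r 0<j r<2 B B₁ = by-sign (tm-±1 (3 * (2 * j)))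
  where
  k : ℕ
  k = 2 * j
  r+1<3 : suc r < 3
  r+1<3 = s≤s r<2
  ¬lower : ¬ LowerTight (4 * k + suc r)
  ¬lower = ¬lowerTight-4q+r k (s≤s z≤n) (m≤n⇒m≤1+n r+1<3)
  ¬upper : ¬ UpperTight (4 * k + suc r)
  ¬upper = ¬upperTight-4q+r k (≤-trans 0<j (m≤n*m j 2)) r+1<3
  by-sign : tm (3 * k) ≡ 1ℤ ⊎ tm (3 * k) ≡ -1ℤ → Bounded (4 * k + suc r)
  by-sign (inj₁ a≡1)  = digit-step B r+1<3 (g-even-left j (suc r) (<⇒≤ r+1<3) (inj₁ a≡1))
    (bounds-same (suc r) (suc r) (bounds B)
      (below-digit k (p34 (value B)) (suc r) (suc r) (Bounds.lower (bounds B)) ≤-refl (s≤s z≤n))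
      (n≤1+n _) ¬lower ¬upper)
  by-sign (inj₂ a≡-1) = digit-step B₁ (s≤s (m∸n≤m 2 r)) (g-even-right j (suc r) (<⇒≤ r+1<3) (inj₁ a≡-1))
    (bounds-carry (suc r) (3 ∸ suc r) (bounds B) (bounds B₁) (p34-value-< B B₁ g[k]≡g[k+1]+1)
      (m≤n⇒m≤1+n r+1<3) (m∸n≤m 2 r) ¬lower ¬upper)
    where
    g[k]≡g[k+1]+1 : g k ≡ g (k + 1) ℤ.+ 1ℤ
    g[k]≡g[k+1]+1 = x′≡x-1⇒x≡x′+1 (trans (g-next-even j) (cong (λ a → g k ℤ.+ a) a≡-1))

even-block : ∀ j r → 0 < j → r < 4 → Bounded (2 * j) → Bounded (2 * j + 1) → Bounded (4 * (2 * j) + r)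
even-block j 0 0<j _ B _  = digit-step B (s≤s z≤n) (g-even-left j 0 z≤n (inj₂ refl))
  (bounds-4k (≤-trans 0<j (m≤n*m j 2)) (bounds B) (lowerTight-4[2j] j 0<j))
even-block j 1 0<j _ B B₁ = even-middle j 0 0<j (s≤s z≤n) B B₁
even-block j 2 0<j _ B B₁ = even-middle j 1 0<j (s≤s (s≤s z≤n)) B B₁
even-block j 3 _   _ _ B₁ = digit-step B₁ (s≤s z≤n) (g-even-right j 3 ≤-refl (inj₂ refl))
  (bounds-4k+3 (bounds B₁))
even-block j (suc (suc (suc (suc _)))) _ (s≤s (s≤s (s≤s (s≤s ())))) _ _

odd-first : ∀ j → 0 < j → Bounded (2 * j) → Bounded (2 * j + 1) → Bounded (2 * j + 1 + 1) →
            Bounded (4 * (2 * j + 1) + 0)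
odd-first j 0<j B₀ B B₁ = by-signs (tm-±1 (3 * (2 * j + 1))) (tm-±1 (3 * (2 * j) + 1))
  where
  k : ℕ
  k = 2 * j + 1
  ¬upper : ¬ UpperTight (4 * k + 0)
  ¬upper = ¬upperTight-4[2j+1]+r j (s≤s z≤n)
  by-signs : tm (3 * k) ≡ 1ℤ ⊎ tm (3 * k) ≡ -1ℤ → tm (3 * (2 * j) + 1) ≡ 1ℤ ⊎ tm (3 * (2 * j) + 1) ≡ -1ℤ →
             Bounded (4 * k + 0)
  by-signs (inj₂ a≡-1) _ = digit-step B (s≤s (s≤s z≤n)) (g-odd-0 j a≡-1)
    (bounds-same 0 1 (bounds B) (below-digit k (p34 (value B)) 0 1 (Bounds.lower (bounds B)) z≤n (s≤s z≤n))
      (s≤s z≤n) ¬lower ¬upper)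
    where
    ¬lower : ¬ LowerTight (4 * k + 0)
    ¬lower tight = contradiction (trans (sym (tm-3*binary k binary)) a≡-1) λ ()
      where
      binary : All (_< 2) (digits 4 k)
      binary = Equivalence.to (lowerTight-4q k (m≤n+m 1 (2 * j))) tight
  by-signs (inj₁ a≡1) (inj₂ u≡-1) = digit-step B₀ (s≤s (s≤s (s≤s z≤n))) (g-odd-0-borrow j (2 * j) a≡1 g[k]≡g[2j]+1)
    (bounds-borrow 0<j (bounds B₀) (p34-value-< B B₀ g[k]≡g[2j]+1) (bounds B))
    where
    g[k]≡g[2j]+1 : g k ≡ g (2 * j) ℤ.+ 1ℤ
    g[k]≡g[2j]+1 = trans (g-next (2 * j)) (cong (λ u → g (2 * j) ℤ.+ - u) u≡-1)
  by-signs (inj₁ a≡1) (inj₁ u≡1) = digit-step B₁ (s≤s (s≤s (s≤s z≤n))) (g-odd-0-borrow j (k + 1) a≡1 g[k]≡g[k+1]+1)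
    (bounds-carry 0 2 (bounds B) (bounds B₁) (p34-value-< B B₁ g[k]≡g[k+1]+1) (s≤s z≤n) ≤-refl ¬lower ¬upper)
    where
    g[k]≡g[k+1]+1 : g k ≡ g (k + 1) ℤ.+ 1ℤ
    g[k]≡g[k+1]+1 = x′≡x-1⇒x≡x′+1 (trans (g-next k) (cong (λ b → g k ℤ.+ - b) (tm-3[2j+1]+1-forced j a≡1 u≡1)))
    -- tightness at 2j would force 2j = 2 p34 (g (2j)) > 2 p34 (g k) ≥ k
    ¬lower : ¬ LowerTight (4 * k + 0)
    ¬lower tight = <-irrefl refl (<-trans 2j<2w (subst (2 * w <_) (sym 2j≡2w₀) (*-monoʳ-< 2 w<w₀)))
      where
      w₀ w : ℕ
      w₀ = p34 (value B₀)
      w = p34 (value B)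
      2j≡2w₀ : 2 * j ≡ 2 * w₀
      2j≡2w₀ = Equivalence.from (Bounds.lower-tight (bounds B₀)) (Equivalence.to (lowerTight-4[2j+1] j 0<j) tight)
      w<w₀ : w < w₀
      w<w₀ = p34-value-< B₀ B (x′≡x-1⇒x≡x′+1 (trans (g-next (2 * j)) (cong (λ u → g (2 * j) ℤ.+ - u) u≡1)))
      2j<2w : 2 * j < 2 * w
      2j<2w = subst (_≤ 2 * w) (+-comm (2 * j) 1) (Bounds.lower (bounds B))

odd<2w : ∀ j w → 2 * j + 1 ≤ 2 * w → 2 * j + 1 < 2 * w
odd<2w j w 2j+1≤2w = ≤∧≢⇒< 2j+1≤2w (λ eq → even≢odd w j (trans (sym eq) (+-comm (2 * j) 1)))

odd-left : ∀ j r → r < 3 → tm (3 * (2 * j + 1) + 1) ≡ -1ℤ ⊎ r ≡ 0 → Bounded (2 * j + 1) →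
           Bounded (4 * (2 * j + 1) + suc r)
odd-left j r r<3 b≡-1⊎r≡0 B = digit-step B r<3 (g-odd-left j r (≤-pred r<3) b≡-1⊎r≡0)
  (bounds-same (suc r) r (bounds B) (below-carry k w (suc r) r (odd<2w j w (Bounds.lower (bounds B))) (s≤s r<3))
    (≤-trans (n≤1+n r) (n≤1+n (suc r))) (¬lowerTight-4q+r k (s≤s z≤n) (s≤s r<3)) (¬upperTight-4[2j+1]+r j (s≤s r<3)))
  where
  k w : ℕ
  k = 2 * j + 1
  w = p34 (value B)

odd-right : ∀ j r → suc r < 3 → tm (3 * (2 * j + 1) + 1) ≡ 1ℤ → Bounded (2 * j + 1) → Bounded (2 * j + 1 + 1) →
            Bounded (4 * (2 * j + 1) + suc (suc r))
odd-right j r r+1<3 b≡1 B B₁ = digit-step B₁ (s≤s (m∸n≤m 2 r)) (g-odd-right j (suc r) (≤-pred r+1<3) b≡1)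
  (bounds-carry (suc (suc r)) (3 ∸ suc r) (bounds B) (bounds B₁) (p34-value-< B B₁ g[k]≡g[k+1]+1)
    (s≤s r+1<3) (m∸n≤m 2 r) (¬lowerTight-4q+r k (s≤s z≤n) (s≤s r+1<3)) (¬upperTight-4[2j+1]+r j (s≤s r+1<3)))
  where
  k : ℕ
  k = 2 * j + 1
  g[k]≡g[k+1]+1 : g k ≡ g (k + 1) ℤ.+ 1ℤ
  g[k]≡g[k+1]+1 = x′≡x-1⇒x≡x′+1 (trans (g-next k) (cong (λ b → g k ℤ.+ - b) b≡1))

odd-block : ∀ j r → 0 < j → r < 4 → Bounded (2 * j) → Bounded (2 * j + 1) → Bounded (2 * j + 1 + 1) →
            Bounded (4 * (2 * j + 1) + r)
odd-block j 0             0<j _           B₀ B B₁ = odd-first j 0<j B₀ B B₁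
odd-block j 1             _   _           _  B _  = odd-left j 0 (s≤s z≤n) (inj₂ refl) B
odd-block j (suc (suc r)) _   (s≤s r+1<3) _  B B₁ with tm-±1 (3 * (2 * j + 1) + 1)
... | inj₁ b≡1  = odd-right j r r+1<3 b≡1 B B₁
... | inj₂ b≡-1 = odd-left j (suc r) r+1<3 (inj₁ b≡-1) B

k+1<4k+r : ∀ k r → 0 < k → k + 1 < 4 * k + r
k+1<4k+r k r 0<k = begin-strict
  k + 1                ≤⟨ n≤1+n (k + 1) ⟩
  suc (k + 1)          <⟨ n<1+n _ ⟩
  suc (suc (k + 1))    ≡⟨ ℕ-Solver.solve (k ∷ []) ⟩
  k + 3 * 1            ≤⟨ +-monoʳ-≤ k (*-monoʳ-≤ 3 0<k) ⟩
  k + 3 * k            ≡⟨ ℕ-Solver.solve (k ∷ []) ⟩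
  4 * k                ≤⟨ m≤m+n (4 * k) r ⟩
  4 * k + r            ∎
  where open ≤-Reasoning

bounded : ∀ n → 0 < n → Bounded n
bounded = <-rec (λ n → 0 < n → Bounded n) go
  where
  go : ∀ n → (∀ {m} → m < n → 0 < m → Bounded m) → 0 < n → Bounded n
  go n rec 0<n with divide 4 n
  ... | k , r , r<4 , refl with even-or-odd k
  ...   | zero , inj₁ refl = bounded-<8 r 0<n (≤-trans r<4 (from-yes (4 ≤? 8)))
  ...   | zero , inj₂ refl = bounded-<8 (4 + r) 0<n (s≤s (s≤s (s≤s (s≤s r<4))))
  ...   | j@(suc _) , inj₁ refl = even-block j r (s≤s z≤n) r<4
    (rec (<-trans (m<m+n (2 * j) (s≤s z≤n)) k+1<n) (≤-trans (s≤s z≤n) (m≤n*m j 2)))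
    (rec k+1<n (m≤n+m 1 (2 * j)))
    where
    k+1<n : 2 * j + 1 < 4 * (2 * j) + r
    k+1<n = k+1<4k+r (2 * j) r (≤-trans (s≤s z≤n) (m≤n*m j 2))
  ...   | j@(suc _) , inj₂ refl = odd-block j r (s≤s z≤n) r<4
    (rec (<-trans (m<m+n (2 * j) (s≤s z≤n)) (<-trans (m<m+n (2 * j + 1) (s≤s z≤n)) k+1<n))
         (≤-trans (s≤s z≤n) (m≤n*m j 2)))
    (rec (<-trans (m<m+n (2 * j + 1) (s≤s z≤n)) k+1<n) (m≤n+m 1 (2 * j)))
    (rec k+1<n (m≤n+m 1 (2 * j + 1)))
    where
    k+1<n : 2 * j + 1 + 1 < 4 * (2 * j + 1) + r
    k+1<n = k+1<4k+r (2 * j + 1) r (m≤n+m 1 (2 * j))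

bounds-of : ∀ n m → 0 < n → - f31 n ≡ + m → Bounds n (p34 m)
bounds-of n m 0<n g≡m = subst (λ y → Bounds n (p34 y)) (ℤ.+-injective (trans (sym (g≡value B)) g≡m)) (bounds B)
  where
  B : Bounded n
  B = bounded n 0<n

-- The power bounds

^-distribʳ-* : ∀ m n o → (m * n) ^ o ≡ m ^ o * n ^ o
^-distribʳ-* m n zero    = refl
^-distribʳ-* m n (suc o) = trans (cong (m * n *_) (^-distribʳ-* m n o)) (interchange m n (m ^ o) (n ^ o))
  where
  interchange : ∀ a b x y → a * b * (x * y) ≡ a * x * (b * y)
  interchange = ℕ-Solver.solve-∀

^-cancelʳ-≤ : ∀ {m o} n .{{_ : NonZero n}} → m ^ n ≤ o ^ n → m ≤ o
^-cancelʳ-≤ {m} {o} n mⁿ≤oⁿ with m ≤? o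
... | yes m≤o = m≤o
... | no  m≰o = contradiction mⁿ≤oⁿ (<⇒≱ (^-monoˡ-< n (≰⇒> m≰o)))

^-cancelˡ-≤ : ∀ m {n o} → 1 < m → m ^ n ≤ m ^ o → n ≤ o
^-cancelˡ-≤ m {n} {o} 1<m mⁿ≤mᵒ with n ≤? o
... | yes n≤o = n≤o
... | no  n≰o = contradiction mⁿ≤mᵒ (<⇒≱ (^-monoʳ-< m 1<m (≰⇒> n≰o)))

0^q≡0 : ∀ q → 0 < q → 0 ^ q ≡ 0
0^q≡0 (suc _) _ = refl

^≤0⇒≡0 : ∀ {b} q → 0 < q → b ^ q ≤ 0 → b ≡ 0
^≤0⇒≡0 {zero}  _ _   _     = refl
^≤0⇒≡0 {suc b} q _ b^q≤0 = contradiction b^q≤0 (<⇒≱ (m^n>0 (suc b) q))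

d^q≤d^[q+t] : ∀ d q t → 0 < q → d ^ q ≤ d ^ (q + t)
d^q≤d^[q+t] zero      q t 0<q = ≤-reflexive (trans (0^q≡0 q 0<q) (sym (0^q≡0 (q + t) (≤-trans 0<q (m≤m+n q t)))))
d^q≤d^[q+t] d@(suc _) q t _   =
  subst (d ^ q ≤_) (sym (^-distribˡ-+-* d q t)) (m≤m*n (d ^ q) (d ^ t) {{>-nonZero (m^n>0 d t)}})

+-^-≤-ordered : ∀ q t {A B a b} → 0 < q → A ^ q ≤ a ^ (q + t) → B ^ q ≤ b ^ (q + t) → A * b ≤ B * a →
                (A + B) ^ q ≤ (a + b) ^ (q + t)
+-^-≤-ordered q t {A} {B} {a} {zero} 0<q A^q≤ B^q≤ _
  with ^≤0⇒≡0 q 0<q (subst (B ^ q ≤_) (0^q≡0 (q + t) (≤-trans 0<q (m≤m+n q t))) B^q≤)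
... | refl = subst₂ (λ x y → x ^ q ≤ y ^ (q + t)) (sym (+-identityʳ A)) (sym (+-identityʳ a)) A^q≤
+-^-≤-ordered q t {A} {B} {a} {b@(suc _)} 0<q A^q≤ B^q≤ Ab≤Ba =
  *-cancelʳ-≤ ((A + B) ^ q) ((a + b) ^ (q + t)) (b ^ q) {{>-nonZero (m^n>0 b q)}} (begin
    (A + B) ^ q * b ^ q        ≡⟨ ^-distribʳ-* (A + B) b q ⟨
    ((A + B) * b) ^ q          ≤⟨ ^-monoˡ-≤ q [A+B]b≤B[a+b] ⟩
    (B * (a + b)) ^ q          ≡⟨ ^-distribʳ-* B (a + b) q ⟩
    B ^ q * (a + b) ^ q        ≤⟨ *-monoˡ-≤ ((a + b) ^ q) B^q≤ ⟩
    b ^ (q + t) * (a + b) ^ q  ≡⟨ cong (_* (a + b) ^ q) (^-distribˡ-+-* b q t) ⟩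
    b ^ q * b ^ t * (a + b) ^ q ≤⟨ *-monoˡ-≤ ((a + b) ^ q) (*-monoʳ-≤ (b ^ q) (^-monoˡ-≤ t (m≤n+m b a))) ⟩
    b ^ q * (a + b) ^ t * (a + b) ^ q ≡⟨ rearrange (b ^ q) ((a + b) ^ t) ((a + b) ^ q) ⟩
    (a + b) ^ q * (a + b) ^ t * b ^ q ≡⟨ cong (_* b ^ q) (^-distribˡ-+-* (a + b) q t) ⟨
    (a + b) ^ (q + t) * b ^ q  ∎)
  where
  open ≤-Reasoning
  [A+B]b≤B[a+b] : (A + B) * b ≤ B * (a + b)
  [A+B]b≤B[a+b] = begin
    (A + B) * b    ≡⟨ *-distribʳ-+ b A B ⟩
    A * b + B * b  ≤⟨ +-monoˡ-≤ (B * b) Ab≤Ba ⟩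
    B * a + B * b  ≡⟨ *-distribˡ-+ B a b ⟨
    B * (a + b)    ∎
  rearrange : ∀ x y z → x * y * z ≡ z * y * x
  rearrange = ℕ-Solver.solve-∀

-- The power function with exponent (q + t)/q ≥ 1 is superadditive.
+-^-≤ : ∀ q t {A B a b} → 0 < q → A ^ q ≤ a ^ (q + t) → B ^ q ≤ b ^ (q + t) → (A + B) ^ q ≤ (a + b) ^ (q + t)
+-^-≤ q t {A} {B} {a} {b} 0<q A^q≤ B^q≤ with ≤-total (A * b) (B * a)
... | inj₁ Ab≤Ba = +-^-≤-ordered q t 0<q A^q≤ B^q≤ Ab≤Ba
... | inj₂ Ba≤Ab =
  subst₂ (λ x y → x ^ q ≤ y ^ (q + t)) (+-comm B A) (+-comm b a) (+-^-≤-ordered q t 0<q B^q≤ A^q≤ Ba≤Ab)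

-- (u/w)^(q+t) ≤ (u/w)^q ≤ (K/W)^q.
rescale : ∀ q t {c u w W K} → 0 < w → u ≤ w → c * w ^ (q + t) ≤ W ^ q → u * W ≤ w * K → c * u ^ (q + t) ≤ K ^ q
rescale q t {c} {u} {w@(suc _)} {W} {K} _ u≤w c*w^p≤W^q uW≤wK =
  *-cancelʳ-≤ (c * u ^ (q + t)) (K ^ q) (w ^ q) {{>-nonZero (m^n>0 w q)}} (begin
    c * u ^ (q + t) * w ^ q        ≡⟨ cong (λ x → c * x * w ^ q) (^-distribˡ-+-* u q t) ⟩
    c * (u ^ q * u ^ t) * w ^ q    ≤⟨ *-monoˡ-≤ (w ^ q) (*-monoʳ-≤ c (*-monoʳ-≤ (u ^ q) (^-monoˡ-≤ t u≤w))) ⟩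
    c * (u ^ q * w ^ t) * w ^ q    ≡⟨ rearrange c (u ^ q) (w ^ t) (w ^ q) ⟩
    u ^ q * (c * (w ^ q * w ^ t))  ≡⟨ cong (λ x → u ^ q * (c * x)) (^-distribˡ-+-* w q t) ⟨
    u ^ q * (c * w ^ (q + t))      ≤⟨ *-monoʳ-≤ (u ^ q) c*w^p≤W^q ⟩
    u ^ q * W ^ q                  ≡⟨ ^-distribʳ-* u W q ⟨
    (u * W) ^ q                    ≤⟨ ^-monoˡ-≤ q uW≤wK ⟩
    (w * K) ^ q                    ≡⟨ ^-distribʳ-* w K q ⟩
    w ^ q * K ^ q                  ≡⟨ *-comm (w ^ q) (K ^ q) ⟩
    K ^ q * w ^ q                  ∎)
  where
  open ≤-Reasoning
  rearrange : ∀ c a b d → c * (a * b) * d ≡ a * (c * (d * b))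
  rearrange = ℕ-Solver.solve-∀

p34^q≤m^[q+t] : ∀ q t → 0 < q → 4 ^ q ≤ 3 ^ (q + t) → ∀ m → p34 m ^ q ≤ m ^ (q + t)
p34^q≤m^[q+t] q t 0<q 4^q≤3^p =
  base-induction 3 (s≤s (s≤s z≤n)) (λ m → p34 m ^ q ≤ m ^ (q + t)) (d^q≤d^[q+t] 0 q t 0<q) step
  where
  step : ∀ m {d} → d < 3 → 0 < 3 * m + d → p34 m ^ q ≤ m ^ (q + t) → p34 (3 * m + d) ^ q ≤ (3 * m + d) ^ (q + t)
  step m {d} d<3 _ ih = begin
    p34 (3 * m + d) ^ q    ≡⟨ cong (_^ q) (p34-step m d<3) ⟩
    (4 * p34 m + d) ^ q    ≤⟨ +-^-≤ q t 0<q high-digits (d^q≤d^[q+t] d q t 0<q) ⟩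
    (3 * m + d) ^ (q + t)  ∎
    where
    open ≤-Reasoning
    high-digits : (4 * p34 m) ^ q ≤ (3 * m) ^ (q + t)
    high-digits = begin
      (4 * p34 m) ^ q           ≡⟨ ^-distribʳ-* 4 (p34 m) q ⟩
      4 ^ q * p34 m ^ q         ≤⟨ *-mono-≤ 4^q≤3^p ih ⟩
      3 ^ (q + t) * m ^ (q + t) ≡⟨ ^-distribʳ-* 3 m (q + t) ⟨
      (3 * m) ^ (q + t)         ∎

-- The only numerical input: log 4 / log 3 ≤ 9/7 ≤ log (5/2) / log 2, i.e. 4^7 ≤ 3^9 and 2^16 ≤ 5^7.
2^q*2^p≤5^q : ∀ p q → 3 ^ p ≤ 4 ^ q → 2 ^ q * 2 ^ p ≤ 5 ^ q
2^q*2^p≤5^q p q 3^p≤4^q = ^-cancelʳ-≤ 7 (begin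
  (2 ^ q * 2 ^ p) ^ 7  ≡⟨ cong (_^ 7) (^-distribˡ-+-* 2 q p) ⟨
  (2 ^ (q + p)) ^ 7    ≡⟨ ^-*-assoc 2 (q + p) 7 ⟩
  2 ^ ((q + p) * 7)    ≤⟨ ^-monoʳ-≤ 2 [q+p]*7≤16*q ⟩
  2 ^ (16 * q)         ≡⟨ ^-*-assoc 2 16 q ⟨
  (2 ^ 16) ^ q         ≤⟨ ^-monoˡ-≤ q (from-yes (2 ^ 16 ≤? 5 ^ 7)) ⟩
  (5 ^ 7) ^ q          ≡⟨ ^-*-assoc 5 7 q ⟩
  5 ^ (7 * q)          ≡⟨ cong (5 ^_) (*-comm 7 q) ⟩
  5 ^ (q * 7)          ≡⟨ ^-*-assoc 5 q 7 ⟨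
  (5 ^ q) ^ 7          ∎)
  where
  open ≤-Reasoning
  p*7≤9*q : p * 7 ≤ 9 * q
  p*7≤9*q = ^-cancelˡ-≤ 3 (s≤s (s≤s z≤n)) (begin
    3 ^ (p * 7)   ≡⟨ ^-*-assoc 3 p 7 ⟨
    (3 ^ p) ^ 7   ≤⟨ ^-monoˡ-≤ 7 3^p≤4^q ⟩
    (4 ^ q) ^ 7   ≡⟨ ^-*-assoc 4 q 7 ⟩
    4 ^ (q * 7)   ≡⟨ cong (4 ^_) (*-comm q 7) ⟩
    4 ^ (7 * q)   ≡⟨ ^-*-assoc 4 7 q ⟨
    (4 ^ 7) ^ q   ≤⟨ ^-monoˡ-≤ q (from-yes (4 ^ 7 ≤? 3 ^ 9)) ⟩
    (3 ^ 9) ^ q   ≡⟨ ^-*-assoc 3 9 q ⟩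
    3 ^ (9 * q)   ∎)
  [q+p]*7≤16*q : (q + p) * 7 ≤ 16 * q
  [q+p]*7≤16*q = begin
    (q + p) * 7    ≡⟨ *-distribʳ-+ 7 q p ⟩
    q * 7 + p * 7  ≤⟨ +-monoʳ-≤ (q * 7) p*7≤9*q ⟩
    q * 7 + 9 * q  ≡⟨ ℕ-Solver.solve (q ∷ []) ⟩
    16 * q         ∎

≤-from-+ : ∀ {x y} s → x + s ≡ y → x ≤ y
≤-from-+ {x} s refl = m≤m+n x s

-- The right side exceeds the left by (2 − d)(12e + 3m + 2).
digit-rescaling : ∀ m e {d} → d ≤ 2 →
                  (3 * suc m + d + 1) * (3 * (4 * (suc m + e) + 2) + 2) ≤
                  (3 * suc m + 3) * (3 * (4 * (suc m + e) + d) + 2)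
digit-rescaling m e {d} d≤2 = +-cancelʳ-≤ (2 * T) _ _ (begin
  (3 * suc m + d + 1) * (3 * (4 * (suc m + e) + 2) + 2) + 2 * T  ≡⟨ identity m e d ⟩
  (3 * suc m + 3) * (3 * (4 * (suc m + e) + d) + 2) + d * T      ≤⟨ +-monoʳ-≤ _ (*-monoˡ-≤ T d≤2) ⟩
  (3 * suc m + 3) * (3 * (4 * (suc m + e) + d) + 2) + 2 * T      ∎)
  where
  open ≤-Reasoning
  T : ℕ
  T = 12 * e + 3 * m + 2
  identity : ∀ m e d → (3 * (1 + m) + d + 1) * (3 * (4 * (1 + m + e) + 2) + 2) + 2 * (12 * e + 3 * m + 2) ≡
                       (3 * (1 + m) + 3) * (3 * (4 * (1 + m + e) + d) + 2) + d * (12 * e + 3 * m + 2)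
  identity = ℕ-Solver.solve-∀

2^q*[m+1]^[q+t]≤[3p34+2]^q : ∀ q t → 0 < q → 3 ^ (q + t) ≤ 4 ^ q →
                             ∀ m → 2 ^ q * (m + 1) ^ (q + t) ≤ (3 * p34 m + 2) ^ q
2^q*[m+1]^[q+t]≤[3p34+2]^q q t 0<q 3^p≤4^q = base-induction 3 (s≤s (s≤s z≤n)) Bound base step
  where
  open ≤-Reasoning
  p : ℕ
  p = q + t
  Bound : ℕ → Set
  Bound m = 2 ^ q * (m + 1) ^ p ≤ (3 * p34 m + 2) ^ q
  base : Bound 0
  base = ≤-reflexive (trans (cong (2 ^ q *_) (^-zeroˡ p)) (*-identityʳ (2 ^ q)))
  3m+3≡[m+1]*3 : ∀ m → 3 * m + 3 ≡ (m + 1) * 3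
  3m+3≡[m+1]*3 = ℕ-Solver.solve-∀
  [3x+2]*4≡3[4x+2]+2 : ∀ x → (3 * x + 2) * 4 ≡ 3 * (4 * x + 2) + 2
  [3x+2]*4≡3[4x+2]+2 = ℕ-Solver.solve-∀
  -- appending the digit 2 multiplies m + 1 by 3 and 3 p34 m + 2 by 4
  append-2 : ∀ m → Bound m → 2 ^ q * (3 * m + 3) ^ p ≤ (3 * (4 * p34 m + 2) + 2) ^ q
  append-2 m ih = begin
    2 ^ q * (3 * m + 3) ^ p           ≡⟨ cong (λ x → 2 ^ q * x ^ p) (3m+3≡[m+1]*3 m) ⟩
    2 ^ q * ((m + 1) * 3) ^ p         ≡⟨ cong (2 ^ q *_) (^-distribʳ-* (m + 1) 3 p) ⟩
    2 ^ q * ((m + 1) ^ p * 3 ^ p)     ≡⟨ *-assoc (2 ^ q) _ _ ⟨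
    2 ^ q * (m + 1) ^ p * 3 ^ p       ≤⟨ *-mono-≤ ih 3^p≤4^q ⟩
    (3 * p34 m + 2) ^ q * 4 ^ q       ≡⟨ ^-distribʳ-* (3 * p34 m + 2) 4 q ⟨
    ((3 * p34 m + 2) * 4) ^ q         ≡⟨ cong (_^ q) ([3x+2]*4≡3[4x+2]+2 (p34 m)) ⟩
    (3 * (4 * p34 m + 2) + 2) ^ q     ∎
  step : ∀ m {d} → d < 3 → 0 < 3 * m + d → Bound m → Bound (3 * m + d)
  step zero    {0} _   () _
  step zero    {1} _   _  _  = 2^q*2^p≤5^q p q 3^p≤4^q
  step zero    {2} _   _  ih = append-2 0 ih
  step zero    {suc (suc (suc _))} (s≤s (s≤s (s≤s ()))) _ _
  step (suc m) {d} d<3 _  ih =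
    subst (λ y → 2 ^ q * (3 * suc m + d + 1) ^ p ≤ (3 * y + 2) ^ q) (sym (p34-step (suc m) d<3))
    (rescale q t {c = 2 ^ q} (s≤s z≤n) u≤w (append-2 (suc m) ih)
      (subst (λ P → (3 * suc m + d + 1) * (3 * (4 * P + 2) + 2) ≤ (3 * suc m + 3) * (3 * (4 * P + d) + 2))
             (m+[n∸m]≡n (y≤p34y (suc m))) (digit-rescaling m (p34 (suc m) ∸ suc m) (≤-pred d<3))))
    where
    u≤w : 3 * suc m + d + 1 ≤ 3 * suc m + 3
    u≤w = subst (_≤ 3 * suc m + 3) (sym (+-assoc (3 * suc m) d 1)) (+-monoʳ-≤ (3 * suc m) (+-monoˡ-≤ 1 (≤-pred d<3)))

p34^q≤m^p : ∀ p q → 0 < q → 4 ^ q < 3 ^ p → ∀ m → p34 m ^ q ≤ m ^ p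
p34^q≤m^p p q 0<q 4^q<3^p m with ≤-total q p
... | inj₁ q≤p = subst (λ x → p34 m ^ q ≤ m ^ x) (m+[n∸m]≡n q≤p)
  (p34^q≤m^[q+t] q (p ∸ q) 0<q (subst (λ x → 4 ^ q ≤ 3 ^ x) (sym (m+[n∸m]≡n q≤p)) (<⇒≤ 4^q<3^p)) m)
... | inj₂ p≤q = contradiction (≤-trans (^-monoˡ-≤ p (n≤1+n 3)) (^-monoʳ-≤ 4 p≤q)) (<⇒≱ 4^q<3^p)

2^q*m^p≤[3p34]^q : ∀ p q → 0 < q → 3 ^ p < 4 ^ q → ∀ m → 0 < m → 2 ^ q * m ^ p ≤ (3 * p34 m) ^ q
2^q*m^p≤[3p34]^q p q 0<q 3^p<4^q m@(suc _) _ with ≤-total q p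
... | inj₁ q≤p = subst (λ x → 2 ^ q * m ^ x ≤ (3 * p34 m) ^ q) (m+[n∸m]≡n q≤p)
  (rescale q (p ∸ q) {c = 2 ^ q} (s≤s z≤n) (m≤m+n m 1)
    (2^q*[m+1]^[q+t]≤[3p34+2]^q q (p ∸ q) 0<q (subst (λ x → 3 ^ x ≤ 4 ^ q) (sym (m+[n∸m]≡n q≤p)) (<⇒≤ 3^p<4^q)) m)
    (subst (λ P → m * (3 * P + 2) ≤ (m + 1) * (3 * P)) (m+[n∸m]≡n (y≤p34y m))
           (≤-from-+ (m + 3 * e) (identity m e))))
  where
  e : ℕ
  e = p34 m ∸ m
  identity : ∀ m e → m * (3 * (m + e) + 2) + (m + 3 * e) ≡ (m + 1) * (3 * (m + e))
  identity = ℕ-Solver.solve-∀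
... | inj₂ p≤q = begin
  2 ^ q * m ^ p          ≤⟨ *-mono-≤ (^-monoˡ-≤ q (n≤1+n 2)) (≤-trans (^-monoʳ-≤ m p≤q) (^-monoˡ-≤ q (y≤p34y m))) ⟩
  3 ^ q * p34 m ^ q      ≡⟨ ^-distribʳ-* 3 (p34 m) q ⟨
  (3 * p34 m) ^ q        ∎
  where open ≤-Reasoning

lower-power : ∀ {n m} → n ≤ 2 * p34 m → ∀ p q → 0 < q → 4 ^ q < 3 ^ p → n ^ q ≤ 2 ^ q * m ^ p
lower-power {n} {m} n≤2P p q 0<q 4^q<3^p = begin
  n ^ q              ≤⟨ ^-monoˡ-≤ q n≤2P ⟩
  (2 * p34 m) ^ q    ≡⟨ ^-distribʳ-* 2 (p34 m) q ⟩
  2 ^ q * p34 m ^ q  ≤⟨ *-monoʳ-≤ (2 ^ q) (p34^q≤m^p p q 0<q 4^q<3^p m) ⟩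
  2 ^ q * m ^ p      ∎
  where open ≤-Reasoning

upper-power : ∀ {n m} → 0 < n → n ≤ 2 * p34 m → 2 * p34 m + 1 ≤ 3 * n →
              ∀ p q → 0 < q → 3 ^ p < 4 ^ q → 4 ^ q * m ^ p ≤ (9 * n ∸ 3) ^ q
upper-power {n} {zero}    0<n n≤0 _ _ _ _ _ = contradiction n≤0 (<⇒≱ 0<n)
upper-power {n} {m@(suc _)} _ _ 2P+1≤3n p q 0<q 3^p<4^q = begin
  4 ^ q * m ^ p              ≡⟨ cong (_* m ^ p) (^-distribʳ-* 2 2 q) ⟩
  2 ^ q * 2 ^ q * m ^ p      ≡⟨ *-assoc (2 ^ q) (2 ^ q) (m ^ p) ⟩
  2 ^ q * (2 ^ q * m ^ p)    ≤⟨ *-monoʳ-≤ (2 ^ q) (2^q*m^p≤[3p34]^q p q 0<q 3^p<4^q m (s≤s z≤n)) ⟩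
  2 ^ q * (3 * p34 m) ^ q    ≡⟨ ^-distribʳ-* 2 (3 * p34 m) q ⟨
  (2 * (3 * p34 m)) ^ q      ≤⟨ ^-monoˡ-≤ q 6P≤9n-3 ⟩
  (9 * n ∸ 3) ^ q            ∎
  where
  open ≤-Reasoning
  2[3x]+3≡3[2x+1] : ∀ x → 2 * (3 * x) + 3 ≡ 3 * (2 * x + 1)
  2[3x]+3≡3[2x+1] = ℕ-Solver.solve-∀
  6P≤9n-3 : 2 * (3 * p34 m) ≤ 9 * n ∸ 3
  6P≤9n-3 = m+n≤o⇒m≤o∸n (2 * (3 * p34 m)) (begin
    2 * (3 * p34 m) + 3  ≡⟨ 2[3x]+3≡3[2x+1] (p34 m) ⟩
    3 * (2 * p34 m + 1)  ≤⟨ *-monoʳ-≤ 3 2P+1≤3n ⟩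
    3 * (3 * n)          ≡⟨ *-assoc 3 3 n ⟨
    9 * n                ∎)

theorem8 :
    ((n m : ℕ) → 1 ≤ n → - f31 n ≡ + m →
        (n ≤ 2 * p34 m × 2 * p34 m + 1 ≤ 3 * n)
      × (n ≡ 2 * p34 m ⇔ In01Star0 (digits 4 n))
      × (2 * p34 m + 1 ≡ 3 * n ⇔ (digits 4 n ≡ 1 ∷ [] ⊎ In2Star3 (digits 4 n))))
    ×
    ((n m : ℕ) → 1 ≤ n → - f31 n ≡ + m →
        ((p q : ℕ) → 1 ≤ q → 4 ^ q < 3 ^ p → n ^ q ≤ 2 ^ q * m ^ p)
      × ((p q : ℕ) → 1 ≤ q → 3 ^ p < 4 ^ q → 4 ^ q * m ^ p ≤ (9 * n ∸ 3) ^ q))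
theorem8 =
  (λ n m 1≤n g≡m → let B = bounds-of n m 1≤n g≡m in
    (Bounds.lower B , Bounds.upper B) , Bounds.lower-tight B , Bounds.upper-tight B) ,
  (λ n m 1≤n g≡m → let B = bounds-of n m 1≤n g≡m in
    lower-power (Bounds.lower B) , upper-power 1≤n (Bounds.lower B) (Bounds.upper B))
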